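{- Let $\mathbb F$ be a finite field. There is an FO+MOD-transduction $\mathsf T_{\mathrm{lm}}$ such that for every matrix class $\mathcal M$ over $\mathbb F$, $\mathsf T_{\mathrm{lm}}(\mathcal M)$ equals the linear-minor closure of $\mathcal M$, i.e. the set of all matrices that are linear minors of some matrix of $\mathcal M$.
   Context: A matrix over $\mathbb F$ with row set $R$ and column set $C$ is identified with the ordered binary structure on $R\uplus C$ with a unary relation marking rows, a total order extending the row and column orders with rows before columns, and for each nonzero $a\in\mathbb F$ a binary relation $E_a(r,c)$ holding iff $r\in R$, $c\in C$ and $M[r,c]=a$. A matrix class is a set of matrices closed under taking submatrices. A weighted sum replaces two consecutive rows $r_i,r_{i+1}$ by $\alpha r_i+\beta r_{i+1}$ for some $\alpha,\beta\in\mathbb F$ (or similarly two consecutive columns); $N$ is a linear minor of $M$ if it is obtained from $M$ by a finite sequence of weighted sums. FO+MOD is first-order logic with extra quantifiers $\exists^{i[p]}x\,\psi(x)$ meaning the number of witnesses is $\equiv i\pmod p$. An interpretation consists of a domain formula $\nu(x)$ and a formula $\rho_R$ for each target relation $R$, producing the structure with domain $\{v:\mathbf A\models\nu(v)\}$ and relations defined by the $\rho_R$ on that domain. A transduction consists of finitely many new unary relation symbols and an interpretation from the extended signature; $\mathsf T(\mathbf A)$ is the set of $\mathsf I(\mathbf A^+)$ over all expansions $\mathbf A^+$ of $\mathbf A$ by the new unary symbols, and $\mathsf T(\mathcal C)=\bigcup_{\mathbf A\in\mathcal C}\mathsf T(\mathbf A)$; it is an FO+MOD-transduction if all its formulas are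 FO+MOD. -}

module Defs where

open import Level using (0ℓ)
open import Data.Nat using (ℕ; zero; suc; _+_; _<_; _≤ᵇ_)
open import Data.Nat.DivMod using (_%_)
open import Data.Fin using (Fin; toℕ; _↑ˡ_; _↑ʳ_; splitAt; inject₁)
import Data.Fin as Fin
open import Data.Bool using (Bool; true; false; _∧_; _∨_; not; if_then_else_)
open import Data.Sum using (_⊎_; inj₁; inj₂)
open import Data.Product using (Σ; ∃; ∃-syntax; _×_; _,_; proj₁; proj₂)
open import Data.List using (List)
open import Data.List.Relation.Unary.Any using (Any)
open import Data.Empty using (⊥)
open import Relation.Nullary using (¬_; Dec)
open import Relation.Nullary.Decidable using (⌊_⌋)
open import Relation.Binary.PropositionalEquality using (_≡_)
open import Function using (_∘_)
open import Function.Definitions using (Injective)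
open import Algebra.Bundles using (CommutativeRing)

-- We additionally require decidable
-- equality (automatic classically for a finite field) and finiteness
-- (a finite list enumerating all elements up to ≈).
record FiniteField : Set₁ where
  field
    commRing : CommutativeRing 0ℓ 0ℓ
  open CommutativeRing commRing public
  field
    0≉1      : ¬ (0# ≈ 1#)
    inverse  : ∀ x → ¬ (x ≈ 0#) → ∃[ y ] (x * y ≈ 1#)
    _≟_      : ∀ x y → Dec (x ≈ y)
    elements : List Carrier
    complete : ∀ x → Any (x ≈_) elements

record Signature : Set₁ where
  field
    Sym   : Set
    arity : Sym → ℕ
open Signature public

record Structure (σ : Signature) : Set where
  field
    size : ℕ
    rel  : (R : Sym σ) → (Fin (arity σ R) → Fin size) → Bool
open Structure public

_≅_ : ∀ {σ} → Structure σ → Structure σ → Set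
_≅_ {σ} A B =
  Σ (Fin (size A) → Fin (size B)) λ f →
  Σ (Fin (size B) → Fin (size A)) λ g →
    (∀ x → g (f x) ≡ x) × (∀ y → f (g y) ≡ y) ×
    (∀ R (t : Fin (arity σ R) → Fin (size A)) → rel A R t ≡ rel B R (f ∘ t))

data Formula (σ : Signature) : ℕ → Set where
  atom  : ∀ {n} (R : Sym σ) → (Fin (arity σ R) → Fin n) → Formula σ n
  eq    : ∀ {n} → Fin n → Fin n → Formula σ n
  neg   : ∀ {n} → Formula σ n → Formula σ n
  conj  : ∀ {n} → Formula σ n → Formula σ n → Formula σ n
  disj  : ∀ {n} → Formula σ n → Formula σ n → Formula σ n
  ex    : ∀ {n} → Formula σ (suc n) → Formula σ n
  all   : ∀ {n} → Formula σ (suc n) → Formula σ n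
  -- exMod i p φ :  ∃^{i [p+1]} x φ  (number of witnesses ≡ i mod (p+1))
  exMod : ∀ {n} → ℕ → ℕ → Formula σ (suc n) → Formula σ n

extend : ∀ {k m} → Fin m → (Fin k → Fin m) → Fin (suc k) → Fin m
extend x ρ Fin.zero    = x
extend x ρ (Fin.suc i) = ρ i

anyFin : ∀ n → (Fin n → Bool) → Bool
anyFin zero    p = false
anyFin (suc n) p = p Fin.zero ∨ anyFin n (p ∘ Fin.suc)

allFin : ∀ n → (Fin n → Bool) → Bool
allFin zero    p = true
allFin (suc n) p = p Fin.zero ∧ allFin n (p ∘ Fin.suc)

countFin : ∀ n → (Fin n → Bool) → ℕ
countFin zero    p = 0
countFin (suc n) p = (if p Fin.zero then 1 else 0) + countFin n (p ∘ Fin.suc)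

_==ℕ_ : ℕ → ℕ → Bool
m ==ℕ n = (m ≤ᵇ n) ∧ (n ≤ᵇ m)

_==F_ : ∀ {n} → Fin n → Fin n → Bool
i ==F j = toℕ i ==ℕ toℕ j

eval : ∀ {σ k} (A : Structure σ) → Formula σ k → (Fin k → Fin (size A)) → Bool
eval A (atom R t)    ρ = rel A R (ρ ∘ t)
eval A (eq i j)      ρ = ρ i ==F ρ j
eval A (neg φ)       ρ = not (eval A φ ρ)
eval A (conj φ ψ)    ρ = eval A φ ρ ∧ eval A ψ ρ
eval A (disj φ ψ)    ρ = eval A φ ρ ∨ eval A ψ ρ
eval A (ex φ)        ρ = anyFin (size A) (λ x → eval A φ (extend x ρ))
eval A (all φ)       ρ = allFin (size A) (λ x → eval A φ (extend x ρ))
eval A (exMod i p φ) ρ =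
  (countFin (size A) (λ x → eval A φ (extend x ρ)) % suc p) ==ℕ (i % suc p)

_⊕_ : Signature → ℕ → Signature
Sym   (σ ⊕ k) = Sym σ ⊎ Fin k
arity (σ ⊕ k) (inj₁ R) = arity σ R
arity (σ ⊕ k) (inj₂ _) = 1

expand : ∀ {σ} k (A : Structure σ) → (Fin k → Fin (size A) → Bool) → Structure (σ ⊕ k)
size (expand k A c) = size A
rel  (expand k A c) (inj₁ R) t = rel A R t
rel  (expand k A c) (inj₂ j) t = c j (t Fin.zero)

record Transduction (σ τ : Signature) : Set where
  field
    colours : ℕ
    ν       : Formula (σ ⊕ colours) 1
    ρ       : (R : Sym τ) → Formula (σ ⊕ colours) (arity τ R)
open Transduction public

IsoToInterp : ∀ {σ τ} (T : Transduction σ τ) (A⁺ : Structure (σ ⊕ colours T))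
              (B : Structure τ) → Set
IsoToInterp {σ} {τ} T A⁺ B =
  Σ (Fin (size B) → Fin (size A⁺)) λ f →
    Injective _≡_ _≡_ f ×
    (∀ v → eval A⁺ (ν T) (λ _ → v) ≡ true → ∃[ b ] (f b ≡ v)) ×
    (∀ b → eval A⁺ (ν T) (λ _ → f b) ≡ true) ×
    (∀ R (t : Fin (arity τ R) → Fin (size B)) → rel B R t ≡ eval A⁺ (ρ T R) (f ∘ t))

_∈T[_] : ∀ {σ τ} → Structure τ → Transduction σ τ → Structure σ → Set
(B ∈T[ T ]) A = ∃[ c ] IsoToInterp T (expand (colours T) A c) B

module Matrices (𝔽 : FiniteField) where
  open FiniteField 𝔽 renaming (_+_ to _+𝔽_; _*_ to _*𝔽_)

  Matrix : ℕ → ℕ → Set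
  Matrix m n = Fin m → Fin n → Carrier

  NonZero𝔽 : Set
  NonZero𝔽 = Σ Carrier λ a → ¬ (a ≈ 0#)

  data MSym : Set where
    row : MSym
    leq : MSym
    E   : NonZero𝔽 → MSym

  MSig : Signature
  Sym   MSig = MSym
  arity MSig row   = 1
  arity MSig leq   = 2
  arity MSig (E _) = 2

  -- the domain Fin (m + n): rows are 0..m-1, columns are m..m+n-1,
  -- the order is the natural order of Fin (m + n).
  encRel : ∀ {m n} → Matrix m n → (R : MSym) → (Fin (arity MSig R) → Fin (m + n)) → Bool
  encRel {m} {n} M row t with splitAt m (t Fin.zero)
  ... | inj₁ _ = true
  ... | inj₂ _ = false
  encRel M leq t = toℕ (t Fin.zero) ≤ᵇ toℕ (t (Fin.suc Fin.zero))
  encRel {m} {n} M (E (a , _)) t with splitAt m (t Fin.zero) | splitAt m (t (Fin.suc Fin.zero))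
  ... | inj₁ r | inj₂ c = ⌊ M r c ≟ a ⌋
  ... | _      | _      = false

  enc : ∀ {m n} → Matrix m n → Structure MSig
  size (enc {m} {n} M) = m + n
  rel  (enc M) = encRel M

  MatrixPred : Set₁
  MatrixPred = ∀ m n → Matrix m n → Set

  StrictlyIncreasing : ∀ {a b} → (Fin a → Fin b) → Set
  StrictlyIncreasing f = ∀ i j → toℕ i < toℕ j → toℕ (f i) < toℕ (f j)

  IsMatrixClass : MatrixPred → Set
  IsMatrixClass 𝓜 =
    ∀ {m n m' n'} (M : Matrix m n) (N : Matrix m' n')
      (f : Fin m' → Fin m) (g : Fin n' → Fin n) →
      StrictlyIncreasing f → StrictlyIncreasing g →
      (∀ i j → N i j ≈ M (f i) (g j)) →
      𝓜 m n M → 𝓜 m' n' N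

  rowSum : ∀ {m n} → Fin m → Carrier → Carrier → Matrix (suc m) n → Matrix m n
  rowSum i α β M r c with Fin.compare r i
  ... | Fin.less _ _    = M (inject₁ r) c
  ... | Fin.equal _     = (α *𝔽 M (inject₁ r) c) +𝔽 (β *𝔽 M (Fin.suc r) c)
  ... | Fin.greater _ _ = M (Fin.suc r) c

  colSum : ∀ {m n} → Fin n → Carrier → Carrier → Matrix m (suc n) → Matrix m n
  colSum j α β M r c with Fin.compare c j
  ... | Fin.less _ _    = M r (inject₁ c)
  ... | Fin.equal _     = (α *𝔽 M r (inject₁ c)) +𝔽 (β *𝔽 M r (Fin.suc c))
  ... | Fin.greater _ _ = M r (Fin.suc c)

  data LinearMinor : ∀ {m n m' n'} → Matrix m' n' → Matrix m n → Set where
    done : ∀ {m n} {M N : Matrix m n} → (∀ i j → N i j ≈ M i j) → LinearMinor N M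
    rowStep : ∀ {m n m' n'} {M : Matrix (suc m) n} {N : Matrix m' n'}
              (i : Fin m) (α β : Carrier) →
              LinearMinor N (rowSum i α β M) → LinearMinor N M
    colStep : ∀ {m n m' n'} {M : Matrix m (suc n)} {N : Matrix m' n'}
              (j : Fin n) (α β : Carrier) →
              LinearMinor N (colSum j α β M) → LinearMinor N M

  InTImage : Transduction MSig MSig → MatrixPred → Structure MSig → Set
  InTImage T 𝓜 B = ∃[ m ] ∃[ n ] Σ (Matrix m n) λ M → 𝓜 m n M × (B ∈T[ T ]) (enc M)

  _∈LMClosure_ : Structure MSig → MatrixPred → Set
  B ∈LMClosure 𝓜 =
    ∃[ m ] ∃[ n ] Σ (Matrix m n) λ M → 𝓜 m n M ×
    ∃[ m' ] ∃[ n' ] Σ (Matrix m' n') λ N → LinearMinor N M × (B ≅ enc N)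

{-# OPTIONS --safe #-}
-- A linear minor N of M is a contraction of M: there are monotone surjections π, σ from the rows and
-- columns of M onto those of N, and weights a, b that are 1 on singleton fibres, such that
-- N[I,J] = Σ_{π r = I} Σ_{σ c = J} a_r b_c M[r,c].  Conversely every contraction is reached by weighted
-- sums, undoing one merge of adjacent rows or columns at a time.  The transduction guesses a contraction
-- by colouring M: one colour marks the first row and column of each block, the others record the
-- weights.  Its domain is the set of block starts, and each entry of N is a double sum over a block.
-- A sum of field elements over a definable set is FO+MOD-definable, since
-- Σ_x f(x) = Σ_t (#{x ∣ f(x) = t} mod char 𝔽) · t, and nesting this twice defines the entries of N.
module Submission where

open import Defs
open import Data.Nat as ℕ using (ℕ; zero; suc; _≤_; _<_; z≤n; s≤s; _∸_; _≤ᵇ_; _<ᵇ_)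
import Data.Nat.Properties as ℕP
open import Data.Nat.DivMod using (_%_; _/_; m≡m%n+[m/n]*n; m%n<n; m<n⇒m%n≡m)
open import Data.Fin as Fin using (Fin; toℕ; _↑ˡ_; _↑ʳ_; splitAt; inject₁)
import Data.Fin.Properties as FinP
open import Data.Bool using (Bool; true; false; _∧_; _∨_; not; if_then_else_; T)
import Data.Bool.Properties
open import Data.Unit using (tt)
open import Data.Sum using (_⊎_; inj₁; inj₂)
open import Data.Product using (Σ; ∃; ∃-syntax; _×_; _,_; proj₁; proj₂)
open import Data.List using (length; lookup)
import Data.List.Relation.Unary.Any as Any
open import Data.List.Relation.Unary.Any.Properties using (lookup-index)
open import Data.Empty using (⊥; ⊥-elim)
open import Relation.Nullary using (¬_; Dec; yes; no)
open import Relation.Nullary.Decidable using (⌊_⌋)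
open import Relation.Binary.PropositionalEquality as P using (_≡_)
open import Function using (_∘_)
import Data.Maybe
open import Data.Maybe using (Maybe; just; nothing)

T⇒≡true : ∀ {b} → T b → b ≡ true
T⇒≡true {true} _ = P.refl

≡true⇒T : ∀ {b} → b ≡ true → T b
≡true⇒T P.refl = tt

≤ᵇ-intro : ∀ {m n} → m ≤ n → (m ≤ᵇ n) ≡ true
≤ᵇ-intro le = T⇒≡true (ℕP.≤⇒≤ᵇ le)

≤ᵇ-elim : ∀ {m n} → (m ≤ᵇ n) ≡ true → m ≤ n
≤ᵇ-elim {m} {n} e = ℕP.≤ᵇ⇒≤ m n (≡true⇒T e)

∧-intro : ∀ {a b} → a ≡ true → b ≡ true → (a ∧ b) ≡ true
∧-intro P.refl P.refl = P.refl

∧-elimˡ : ∀ {a b} → (a ∧ b) ≡ true → a ≡ true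
∧-elimˡ {true} _ = P.refl

∧-elimʳ : ∀ {a b} → (a ∧ b) ≡ true → b ≡ true
∧-elimʳ {true} e = e

∨-elim : ∀ {a b} → (a ∨ b) ≡ true → a ≡ true ⊎ b ≡ true
∨-elim {true} _ = inj₁ P.refl
∨-elim {false} e = inj₂ e

∨-introˡ : ∀ {a b} → a ≡ true → (a ∨ b) ≡ true
∨-introˡ P.refl = P.refl

∨-introʳ : ∀ {a b} → b ≡ true → (a ∨ b) ≡ true
∨-introʳ {true} _ = P.refl
∨-introʳ {false} e = e

not-elim : ∀ {a} → not a ≡ true → a ≡ false
not-elim {false} _ = P.refl

not-intro : ∀ {a} → a ≡ false → not a ≡ true
not-intro P.refl = P.refl

true≢false : ∀ {a} → a ≡ true → a ≡ false → ⊥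
true≢false P.refl ()

∧₃-elim : ∀ a b c → (a ∧ (b ∧ c)) ≡ true → (a ≡ true) × (b ≡ true) × (c ≡ true)
∧₃-elim true true true _ = P.refl , P.refl , P.refl

∧-elim : ∀ a b → (a ∧ b) ≡ true → (a ≡ true) × (b ≡ true)
∧-elim true true _ = P.refl , P.refl

Bool-ext : ∀ {a b} → (a ≡ true → b ≡ true) → (b ≡ true → a ≡ true) → a ≡ b
Bool-ext {false} {false} f g = P.refl
Bool-ext {false} {true} f g with g P.refl
... | ()
Bool-ext {true} {false} f g with f P.refl
... | ()
Bool-ext {true} {true} f g = P.refl

==ℕ-intro : ∀ {m n} → m ≡ n → (m ==ℕ n) ≡ true
==ℕ-intro {m} P.refl = ∧-intro (≤ᵇ-intro {m} {m} ℕP.≤-refl) (≤ᵇ-intro {m} {m} ℕP.≤-refl)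

==ℕ-elim : ∀ {m n} → (m ==ℕ n) ≡ true → m ≡ n
==ℕ-elim e = ℕP.≤-antisym (≤ᵇ-elim (∧-elimˡ e)) (≤ᵇ-elim (∧-elimʳ e))

anyFin-intro : ∀ n (p : Fin n → Bool) i → p i ≡ true → anyFin n p ≡ true
anyFin-intro (suc n) p Fin.zero e = ∨-introˡ e
anyFin-intro (suc n) p (Fin.suc i) e = ∨-introʳ {p Fin.zero} (anyFin-intro n (p ∘ Fin.suc) i e)

anyFin-elim : ∀ n (p : Fin n → Bool) → anyFin n p ≡ true → ∃[ i ] (p i ≡ true)
anyFin-elim (suc n) p e with ∨-elim {p Fin.zero} e
... | inj₁ q = Fin.zero , q
... | inj₂ q with anyFin-elim n (p ∘ Fin.suc) q
...   | i , r = Fin.suc i , r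

allFin-intro : ∀ n (p : Fin n → Bool) → (∀ i → p i ≡ true) → allFin n p ≡ true
allFin-intro zero p h = P.refl
allFin-intro (suc n) p h = ∧-intro (h Fin.zero) (allFin-intro n (p ∘ Fin.suc) (h ∘ Fin.suc))

allFin-elim : ∀ n (p : Fin n → Bool) → allFin n p ≡ true → ∀ i → p i ≡ true
allFin-elim (suc n) p e Fin.zero = ∧-elimˡ e
allFin-elim (suc n) p e (Fin.suc i) = allFin-elim n (p ∘ Fin.suc) (∧-elimʳ {p Fin.zero} e) i

anyFin-false : ∀ n (p : Fin n → Bool) → (∀ i → p i ≡ false) → anyFin n p ≡ false
anyFin-false zero p h = P.refl
anyFin-false (suc n) p h rewrite h Fin.zero = anyFin-false n (p ∘ Fin.suc) (h ∘ Fin.suc)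

anyFin-cong : ∀ n (p q : Fin n → Bool) → (∀ i → p i ≡ q i) → anyFin n p ≡ anyFin n q
anyFin-cong zero p q h = P.refl
anyFin-cong (suc n) p q h = P.cong₂ _∨_ (h Fin.zero) (anyFin-cong n _ _ (h ∘ Fin.suc))

allFin-cong : ∀ n (p q : Fin n → Bool) → (∀ i → p i ≡ q i) → allFin n p ≡ allFin n q
allFin-cong zero p q h = P.refl
allFin-cong (suc n) p q h = P.cong₂ _∧_ (h Fin.zero) (allFin-cong n _ _ (h ∘ Fin.suc))

==F-refl : ∀ {n} (x : Fin n) → (x ==F x) ≡ true
==F-refl x = ==ℕ-intro {toℕ x} P.refl

<ᵇ-intro : ∀ {a b : ℕ} → a < b → (a ℕ.<ᵇ b) ≡ true
<ᵇ-intro {a} {b} lt = T⇒≡true (ℕP.<⇒<ᵇ lt)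

<ᵇ-elim : ∀ {a b : ℕ} → (a ℕ.<ᵇ b) ≡ true → a < b
<ᵇ-elim {a} {b} h = ℕP.<ᵇ⇒< a b (≡true⇒T h)

true≡false⇒⊥ : true ≡ false → ⊥
true≡false⇒⊥ ()

∧-false-intro : ∀ {b c} → (b ≡ true → c ≡ false) → (b ∧ c) ≡ false
∧-false-intro {false} h = P.refl
∧-false-intro {true} h = h P.refl

not≤ᵇ-intro : ∀ {a b : ℕ} → a < b → not (b ≤ᵇ a) ≡ true
not≤ᵇ-intro {a} {b} lt with b ≤ᵇ a in eqb
... | true = ⊥-elim (ℕP.<⇒≱ lt (≤ᵇ-elim eqb))
... | false = P.refl

not≤ᵇ-elim : ∀ {a b : ℕ} → not (b ≤ᵇ a) ≡ true → a < b
not≤ᵇ-elim {a} {b} h with b ≤ᵇ a in eqb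
... | false = ℕP.≰⇒> (λ le → true≢false (≤ᵇ-intro le) eqb)

splitView : ∀ m n (k : Fin (m ℕ.+ n)) → (∃[ i ] (k ≡ i ↑ˡ n)) ⊎ (∃[ j ] (k ≡ m ↑ʳ j))
splitView m n k with splitAt m k in eqv
... | inj₁ r = inj₁ (r , P.trans (P.sym (FinP.join-splitAt m n k)) (P.cong (Fin.join m n) eqv))
... | inj₂ c' = inj₂ (c' , P.trans (P.sym (FinP.join-splitAt m n k)) (P.cong (Fin.join m n) eqv))

↑ˡ<↑ʳ : ∀ {m n} (i : Fin m) (j : Fin n) → toℕ (i ↑ˡ n) < toℕ (m ↑ʳ j)
↑ˡ<↑ʳ {m} {n} i j = P.subst₂ _<_ (P.sym (FinP.toℕ-↑ˡ i n)) (P.sym (FinP.toℕ-↑ʳ m j)) (ℕP.<-≤-trans (FinP.toℕ<n i) (ℕP.m≤m+n m (toℕ j)))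

first? : ∀ {k} → (Fin k → Bool) → Maybe (Fin k)
first? {zero} p = nothing
first? {suc k} p = if p Fin.zero then just Fin.zero else Data.Maybe.map Fin.suc (first? (p ∘ Fin.suc))

firstOr : ∀ {k} → (Fin k → Bool) → Fin k → Fin k
firstOr p d = Data.Maybe.fromMaybe d (first? p)

first?-cong : ∀ {k} (p q : Fin k → Bool) → (∀ i → p i ≡ q i) → first? p ≡ first? q
first?-cong {zero} p q h = P.refl
first?-cong {suc k} p q h rewrite h Fin.zero | first?-cong (p ∘ Fin.suc) (q ∘ Fin.suc) (h ∘ Fin.suc) = P.refl

firstOr-cong : ∀ {k} (p q : Fin k → Bool) d → (∀ i → p i ≡ q i) → firstOr p d ≡ firstOr q d
firstOr-cong p q d h rewrite first?-cong p q h = P.refl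

first?-holds : ∀ {k} (p : Fin k → Bool) {j} → first? p ≡ just j → p j ≡ true
first?-holds {suc k} p e with p Fin.zero in eq
first?-holds {suc k} p P.refl | true = eq
... | false with first? (p ∘ Fin.suc) in eq2
first?-holds {suc k} p P.refl | false | just j = first?-holds (p ∘ Fin.suc) eq2

first?-least : ∀ {k} (p : Fin k → Bool) {j} → first? p ≡ just j → ∀ i → toℕ i < toℕ j → p i ≡ false
first?-least {suc k} p e i lt with p Fin.zero in eq
first?-least {suc k} p P.refl i () | true
... | false with first? (p ∘ Fin.suc) in eq2
first?-least {suc k} p P.refl Fin.zero lt | false | just j = eq
first?-least {suc k} p P.refl (Fin.suc i) (s≤s lt) | false | just j = first?-least (p ∘ Fin.suc) eq2 i lt

first?-nothing : ∀ {k} (p : Fin k → Bool) → first? p ≡ nothing → ∀ i → p i ≡ false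
first?-nothing {suc k} p e i with p Fin.zero in eq
first?-nothing {suc k} p () i | true
... | false with first? (p ∘ Fin.suc) in eq2
first?-nothing {suc k} p P.refl Fin.zero | false | nothing = eq
first?-nothing {suc k} p P.refl (Fin.suc i) | false | nothing = first?-nothing (p ∘ Fin.suc) eq2 i

firstOr-holds : ∀ {k} (p : Fin k → Bool) d j → p j ≡ true → p (firstOr p d) ≡ true
firstOr-holds p d j pj with first? p in eq
... | just i = first?-holds p eq
... | nothing with P.trans (P.sym pj) (first?-nothing p eq j)
...   | ()

firstOr-least : ∀ {k} (p : Fin k → Bool) d j → p j ≡ true → ∀ i → toℕ i < toℕ (firstOr p d) → p i ≡ false
firstOr-least p d j pj i lt with first? p in eq
... | just i' = first?-least p eq i lt
... | nothing with P.trans (P.sym pj) (first?-nothing p eq j)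
...   | ()

countFin-cong : ∀ K (p q : Fin K → Bool) → (∀ i → p i ≡ q i) → countFin K p ≡ countFin K q
countFin-cong zero p q h = P.refl
countFin-cong (suc K) p q h = P.cong₂ ℕ._+_ (P.cong (λ b → if b then 1 else 0) (h Fin.zero)) (countFin-cong K _ _ (h ∘ Fin.suc))

first?-none : ∀ {k} (p : Fin k → Bool) → (∀ i → p i ≡ false) → first? p ≡ nothing
first?-none {zero} p h = P.refl
first?-none {suc k} p h rewrite h Fin.zero | first?-none (p ∘ Fin.suc) (h ∘ Fin.suc) = P.refl

firstOr-none : ∀ {k} (p : Fin k → Bool) d → (∀ i → p i ≡ false) → firstOr p d ≡ d
firstOr-none p d h rewrite first?-none p h = P.refl

eqFin : ∀ {k} → Fin k → Fin k → Bool
eqFin i j = ⌊ i Fin.≟ j ⌋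

eqFin-intro : ∀ {k} {i j : Fin k} → i ≡ j → eqFin i j ≡ true
eqFin-intro {i = i} {j} e with i Fin.≟ j
... | yes _ = P.refl
... | no ne = ⊥-elim (ne e)

eqFin-elim : ∀ {k} {i j : Fin k} → eqFin i j ≡ true → i ≡ j
eqFin-elim {i = i} {j} h with i Fin.≟ j
... | yes e = e

eqFin-false : ∀ {k} {i j : Fin k} → ¬ (i ≡ j) → eqFin i j ≡ false
eqFin-false {i = i} {j} ne with i Fin.≟ j
... | yes e = ⊥-elim (ne e)
... | no _ = P.refl

eqFin-firstOr : ∀ {k} (p : Fin k → Bool) d t →
  ((allFin k (λ j → not (toℕ j ℕ.<ᵇ toℕ t) ∨ not (p j)) ∧ p t) ∨ (allFin k (λ j → not (p j)) ∧ eqFin t d)) ≡ eqFin (firstOr p d) t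
eqFin-firstOr {k} p d t = Bool-ext fwd bwd
  where
  isFirstHolder isDefault : Bool
  isFirstHolder = allFin k (λ j → not (toℕ j ℕ.<ᵇ toℕ t) ∨ not (p j)) ∧ p t
  isDefault = allFin k (λ j → not (p j)) ∧ eqFin t d
  fwd : (isFirstHolder ∨ isDefault) ≡ true → eqFin (firstOr p d) t ≡ true
  fwd h with ∨-elim {isFirstHolder} h
  ... | inj₁ h1 with ∧-elim (allFin k (λ j → not (toℕ j ℕ.<ᵇ toℕ t) ∨ not (p j))) (p t) h1
  ...   | ha , pt = eqFin-intro (FinP.toℕ-injective (ℕP.≤-antisym le1 le2))
    where
    fd : Fin k
    fd = firstOr p d
    le1 : toℕ fd ≤ toℕ t
    le1 = ℕP.≮⇒≥ (λ lt → true≢false pt (firstOr-least p d t pt t lt))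
    le2 : toℕ t ≤ toℕ fd
    le2 = ℕP.≮⇒≥ (λ lt → lem (∨-elim {not (toℕ fd ℕ.<ᵇ toℕ t)} (allFin-elim k _ ha fd)) lt)
      where
      lem : not (toℕ fd ℕ.<ᵇ toℕ t) ≡ true ⊎ not (p fd) ≡ true → toℕ fd < toℕ t → ⊥
      lem (inj₁ q) lt = true≢false (<ᵇ-intro lt) (not-elim q)
      lem (inj₂ q) lt = true≢false (firstOr-holds p d t pt) (not-elim q)
  fwd h | inj₂ h2 with ∧-elim (allFin k (λ j → not (p j))) (eqFin t d) h2
  ... | ha , td = eqFin-intro (P.trans (firstOr-none p d (λ i → not-elim (allFin-elim k _ ha i))) (P.sym (eqFin-elim td)))
  bwd : eqFin (firstOr p d) t ≡ true → (isFirstHolder ∨ isDefault) ≡ true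
  bwd h with eqFin-elim h | FinP.any? (λ j → p j Data.Bool.≟ true)
  ... | P.refl | yes (j , pj) = ∨-introˡ (∧-intro (allFin-intro k _ lem) (firstOr-holds p d j pj))
    where
    lem : ∀ i → (not (toℕ i ℕ.<ᵇ toℕ (firstOr p d)) ∨ not (p i)) ≡ true
    lem i with toℕ i ℕ.<ᵇ toℕ (firstOr p d) in eqi
    ... | false = P.refl
    ... | true = ∨-introʳ {false} (not-intro (firstOr-least p d j pj i (<ᵇ-elim eqi)))
  ... | P.refl | no none = ∨-introʳ {allFin k (λ j → not (toℕ j ℕ.<ᵇ toℕ (firstOr p d)) ∨ not (p j)) ∧ p (firstOr p d)}
        (∧-intro (allFin-intro k _ (λ i → not-intro (allF i))) (eqFin-intro (firstOr-none p d allF)))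
    where
    allF : ∀ i → p i ≡ false
    allF i with p i in eqi
    ... | true = ⊥-elim (none (i , eqi))
    ... | false = P.refl

-- Blocks of consecutive positions

zeroOf : ∀ {k} → Fin k → Fin k
zeroOf Fin.zero = Fin.zero
zeroOf (Fin.suc _) = Fin.zero

toℕ-zeroOf : ∀ {k} (x : Fin k) → toℕ (zeroOf x) ≡ 0
toℕ-zeroOf Fin.zero = P.refl
toℕ-zeroOf (Fin.suc _) = P.refl

enumerate : ∀ {k} (marked : Fin k → Bool) → Fin (countFin k marked) → Fin k
enumerate {suc k} marked i with marked Fin.zero
enumerate {suc k} marked Fin.zero | true = Fin.zero
enumerate {suc k} marked (Fin.suc i) | true = Fin.suc (enumerate (marked ∘ Fin.suc) i)
enumerate {suc k} marked i | false = Fin.suc (enumerate (marked ∘ Fin.suc) i)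

enumerate-marked : ∀ {k} (marked : Fin k → Bool) i → marked (enumerate marked i) ≡ true
enumerate-marked {suc k} marked i with marked Fin.zero in eq0
enumerate-marked {suc k} marked Fin.zero | true = eq0
enumerate-marked {suc k} marked (Fin.suc i) | true = enumerate-marked (marked ∘ Fin.suc) i
enumerate-marked {suc k} marked i | false = enumerate-marked (marked ∘ Fin.suc) i

enumerate-mono : ∀ {k} (marked : Fin k → Bool) i j → toℕ i < toℕ j → toℕ (enumerate marked i) < toℕ (enumerate marked j)
enumerate-mono {suc k} marked i j lt with marked Fin.zero
enumerate-mono {suc k} marked Fin.zero (Fin.suc j) lt | true = s≤s z≤n
enumerate-mono {suc k} marked (Fin.suc i) (Fin.suc j) (s≤s lt) | true = s≤s (enumerate-mono (marked ∘ Fin.suc) i j lt)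
enumerate-mono {suc k} marked i j lt | false = s≤s (enumerate-mono (marked ∘ Fin.suc) i j lt)

enumerate-onto : ∀ {k} (marked : Fin k → Bool) s → marked s ≡ true → ∃[ i ] (enumerate marked i ≡ s)
enumerate-onto {suc k} marked s h with marked Fin.zero in eq0
enumerate-onto {suc k} marked Fin.zero h | true = Fin.zero , P.refl
enumerate-onto {suc k} marked (Fin.suc s) h | true with enumerate-onto (marked ∘ Fin.suc) s h
... | i , e = Fin.suc i , P.cong Fin.suc e
enumerate-onto {suc k} marked Fin.zero h | false = ⊥-elim (true≢false h eq0)
enumerate-onto {suc k} marked (Fin.suc s) h | false with enumerate-onto (marked ∘ Fin.suc) s h
... | i , e = i , P.cong Fin.suc e

countFin-none : ∀ K (p : Fin K → Bool) → (∀ i → p i ≡ false) → countFin K p ≡ 0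
countFin-none zero p h = P.refl
countFin-none (suc K) p h rewrite h Fin.zero = countFin-none K (p ∘ Fin.suc) (h ∘ Fin.suc)

countFin-≤ : ∀ K (p : Fin K → Bool) → countFin K p ≤ K
countFin-≤ zero p = z≤n
countFin-≤ (suc K) p with p Fin.zero
... | true = s≤s (countFin-≤ K (p ∘ Fin.suc))
... | false = ℕP.m≤n⇒m≤1+n (countFin-≤ K (p ∘ Fin.suc))

countFin-downClosed : ∀ K (p : Fin K → Bool) → (∀ i j → toℕ i ≤ toℕ j → p j ≡ true → p i ≡ true) →
     ∀ j → (p j ≡ true → toℕ j < countFin K p) × (toℕ j < countFin K p → p j ≡ true)
countFin-downClosed (suc K) p dc j with p Fin.zero in eq0
... | false = (λ h → ⊥-elim (true≢false (dc Fin.zero j z≤n h) eq0)) ,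
              (λ lt → ⊥-elim (ℕP.n≮0 (P.subst (toℕ j <_) (countFin-none K (p ∘ Fin.suc) (λ i → lem i (p (Fin.suc i)) P.refl)) lt)))
  where
  lem : ∀ i b → p (Fin.suc i) ≡ b → b ≡ false
  lem i false _ = P.refl
  lem i true e = ⊥-elim (true≢false (dc Fin.zero (Fin.suc i) z≤n e) eq0)
... | true with j
...   | Fin.zero = (λ _ → s≤s z≤n) , (λ _ → eq0)
...   | Fin.suc j' = (λ h → s≤s (proj₁ ih h)) , (λ { (s≤s lt) → proj₂ ih lt })
  where
  ih : (p (Fin.suc j') ≡ true → toℕ j' < countFin K (p ∘ Fin.suc)) × (toℕ j' < countFin K (p ∘ Fin.suc) → p (Fin.suc j') ≡ true)
  ih = countFin-downClosed K (p ∘ Fin.suc) (λ i j le h → dc (Fin.suc i) (Fin.suc j) (s≤s le) h) j'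

module Blocks {k : ℕ} (marked : Fin k → Bool) (marked-0 : ∀ i → toℕ i ≡ 0 → marked i ≡ true) where
  #blocks : ℕ
  #blocks = countFin k marked

  opaque
    blockStart : Fin #blocks → Fin k
    blockStart = enumerate marked

  opaque
    unfolding blockStart
    blockStart-marked : ∀ i → marked (blockStart i) ≡ true
    blockStart-marked = enumerate-marked marked
    blockStart-mono : ∀ i j → toℕ i < toℕ j → toℕ (blockStart i) < toℕ (blockStart j)
    blockStart-mono = enumerate-mono marked
    blockStart-onto : ∀ s → marked s ≡ true → ∃[ i ] (blockStart i ≡ s)
    blockStart-onto = enumerate-onto marked

  blockStart-mono-≤ : ∀ i j → toℕ i ≤ toℕ j → toℕ (blockStart i) ≤ toℕ (blockStart j)
  blockStart-mono-≤ i j le with ℕP.m≤n⇒m<n∨m≡n le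
  ... | inj₁ lt = ℕP.<⇒≤ (blockStart-mono i j lt)
  ... | inj₂ i≡j = ℕP.≤-reflexive (P.cong (toℕ ∘ blockStart) (FinP.toℕ-injective i≡j))

  blockStart-cancel-< : ∀ i j → toℕ (blockStart i) < toℕ (blockStart j) → toℕ i < toℕ j
  blockStart-cancel-< i j lt = ℕP.≰⇒> (λ le → ℕP.<⇒≱ lt (blockStart-mono-≤ j i le))

  blockStart-cancel-≤ : ∀ i j → toℕ (blockStart i) ≤ toℕ (blockStart j) → toℕ i ≤ toℕ j
  blockStart-cancel-≤ i j le = ℕP.≮⇒≥ (λ lt → ℕP.<⇒≱ (blockStart-mono j i lt) le)

  startsUpTo : Fin k → Fin #blocks → Bool
  startsUpTo r i = toℕ (blockStart i) ≤ᵇ toℕ r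

  startsUpTo-downClosed : ∀ r i j → toℕ i ≤ toℕ j → startsUpTo r j ≡ true → startsUpTo r i ≡ true
  startsUpTo-downClosed r i j le h = ≤ᵇ-intro (ℕP.≤-trans (blockStart-mono-≤ i j le) (≤ᵇ-elim h))

  #startsUpTo : Fin k → ℕ
  #startsUpTo r = countFin #blocks (startsUpTo r)

  firstBlock : Fin k → Fin #blocks
  firstBlock r = proj₁ (blockStart-onto (zeroOf r) (marked-0 (zeroOf r) (toℕ-zeroOf r)))

  blockStart-firstBlock : ∀ r → blockStart (firstBlock r) ≡ zeroOf r
  blockStart-firstBlock r = proj₂ (blockStart-onto (zeroOf r) (marked-0 (zeroOf r) (toℕ-zeroOf r)))

  firstBlock-startsUpTo : ∀ r → startsUpTo r (firstBlock r) ≡ true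
  firstBlock-startsUpTo r = ≤ᵇ-intro (P.subst (_≤ toℕ r) (P.sym toℕ-start) z≤n)
    where
    toℕ-start : toℕ (blockStart (firstBlock r)) ≡ 0
    toℕ-start = P.trans (P.cong toℕ (blockStart-firstBlock r)) (toℕ-zeroOf r)

  startsUpTo-count : ∀ r i → (startsUpTo r i ≡ true → toℕ i < #startsUpTo r) × (toℕ i < #startsUpTo r → startsUpTo r i ≡ true)
  startsUpTo-count r = countFin-downClosed #blocks (startsUpTo r) (startsUpTo-downClosed r)

  suc-#startsUpTo∸1 : ∀ r → suc (#startsUpTo r ∸ 1) ≡ #startsUpTo r
  suc-#startsUpTo∸1 r = P.trans (ℕP.+-comm 1 (#startsUpTo r ∸ 1)) (ℕP.m∸n+n≡m #startsUpTo-pos)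
    where
    #startsUpTo-pos : 1 ≤ #startsUpTo r
    #startsUpTo-pos = ℕP.≤-trans (s≤s z≤n) (proj₁ (startsUpTo-count r (firstBlock r)) (firstBlock-startsUpTo r))

  #startsUpTo∸1< : ∀ r → #startsUpTo r ∸ 1 < #blocks
  #startsUpTo∸1< r = P.subst (_≤ #blocks) (P.sym (suc-#startsUpTo∸1 r)) (countFin-≤ #blocks (startsUpTo r))

  opaque
    blockOf : Fin k → Fin #blocks
    blockOf r = Fin.fromℕ< (#startsUpTo∸1< r)

  opaque
    unfolding blockOf
    toℕ-blockOf : ∀ r → toℕ (blockOf r) ≡ #startsUpTo r ∸ 1
    toℕ-blockOf r = FinP.toℕ-fromℕ< (#startsUpTo∸1< r)

  blockStart≤⇒≤blockOf : ∀ i r → toℕ (blockStart i) ≤ toℕ r → toℕ i ≤ toℕ (blockOf r)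
  blockStart≤⇒≤blockOf i r le =
    P.subst (toℕ i ≤_) (P.sym (toℕ-blockOf r))
      (ℕP.≤-pred (P.subst (suc (toℕ i) ≤_) (P.sym (suc-#startsUpTo∸1 r)) (proj₁ (startsUpTo-count r i) (≤ᵇ-intro le))))

  ≤blockOf⇒blockStart≤ : ∀ i r → toℕ i ≤ toℕ (blockOf r) → toℕ (blockStart i) ≤ toℕ r
  ≤blockOf⇒blockStart≤ i r le =
    ≤ᵇ-elim (proj₂ (startsUpTo-count r i)
      (P.subst (suc (toℕ i) ≤_) (suc-#startsUpTo∸1 r) (s≤s (P.subst (toℕ i ≤_) (toℕ-blockOf r) le))))

  blockOf-blockStart : ∀ i → blockOf (blockStart i) ≡ i
  blockOf-blockStart i = FinP.toℕ-injective (ℕP.≤-antisym le1 (blockStart≤⇒≤blockOf i (blockStart i) ℕP.≤-refl))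
    where
    le1 : toℕ (blockOf (blockStart i)) ≤ toℕ i
    le1 = blockStart-cancel-≤ (blockOf (blockStart i)) i (≤blockOf⇒blockStart≤ (blockOf (blockStart i)) (blockStart i) ℕP.≤-refl)

  blockOf-mono : ∀ r s → toℕ r ≤ toℕ s → toℕ (blockOf r) ≤ toℕ (blockOf s)
  blockOf-mono r s le = blockStart≤⇒≤blockOf (blockOf r) s (ℕP.≤-trans (≤blockOf⇒blockStart≤ (blockOf r) r ℕP.≤-refl) le)

  blockOf-onto : ∀ i → ∃[ r ] (blockOf r ≡ i)
  blockOf-onto i = blockStart i , blockOf-blockStart i

  blockStart-blockOf : ∀ s → marked s ≡ true → blockStart (blockOf s) ≡ s
  blockStart-blockOf s h with blockStart-onto s h
  ... | i , P.refl = P.cong blockStart (blockOf-blockStart i)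

  NoStartBetween : Fin k → Fin k → Set
  NoStartBetween x r = ∀ l → marked l ≡ true → toℕ x < toℕ l → toℕ l ≤ toℕ r → ⊥

  blockOf⇒between : ∀ I r → blockOf r ≡ I → (toℕ (blockStart I) ≤ toℕ r) × NoStartBetween (blockStart I) r
  blockOf⇒between I r P.refl = ≤blockOf⇒blockStart≤ (blockOf r) r ℕP.≤-refl , gap
    where
    gap : NoStartBetween (blockStart (blockOf r)) r
    gap l stl lt le with blockStart-onto l stl
    ... | j , P.refl = ℕP.<⇒≱ (blockStart-cancel-< (blockOf r) j lt) (blockStart≤⇒≤blockOf j r le)

  between⇒blockOf : ∀ I r → toℕ (blockStart I) ≤ toℕ r → NoStartBetween (blockStart I) r → blockOf r ≡ I
  between⇒blockOf I r le gap = FinP.toℕ-injective (ℕP.≤-antisym le1 (blockStart≤⇒≤blockOf I r le))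
    where
    le1 : toℕ (blockOf r) ≤ toℕ I
    le1 = ℕP.≮⇒≥ (λ lt → gap (blockStart (blockOf r)) (blockStart-marked (blockOf r))
        (blockStart-mono I (blockOf r) lt) (≤blockOf⇒blockStart≤ (blockOf r) r ℕP.≤-refl))

module Fibres {k k' : ℕ} (π : Fin k → Fin k') (mono : ∀ r s → toℕ r ≤ toℕ s → toℕ (π r) ≤ toℕ (π s))
             (surj : ∀ i → ∃[ r ] (π r ≡ i)) where
  isFirst : Fin k → Bool
  isFirst r = not (anyFin k (λ s → (toℕ s ℕ.<ᵇ toℕ r) ∧ eqFin (π s) (π r)))

  inFibre : Fin k' → Fin k → Bool
  inFibre i r = eqFin (π r) i

  firstOf : Fin k' → Fin k
  firstOf i = firstOr (inFibre i) (proj₁ (surj i))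

  π-firstOf : ∀ i → π (firstOf i) ≡ i
  π-firstOf i = eqFin-elim (firstOr-holds (inFibre i) (proj₁ (surj i)) (proj₁ (surj i)) (eqFin-intro (proj₂ (surj i))))

  firstOf-least : ∀ i r → π r ≡ i → toℕ (firstOf i) ≤ toℕ r
  firstOf-least i r e = ℕP.≮⇒≥ (λ lt → true≢false (eqFin-intro e) (firstOr-least (inFibre i) (proj₁ (surj i)) r (eqFin-intro e) r lt))

  isFirst-firstOf : ∀ i → isFirst (firstOf i) ≡ true
  isFirst-firstOf i = not-intro (anyFin-false k _ λ s → lem s)
    where
    lem : ∀ s → ((toℕ s ℕ.<ᵇ toℕ (firstOf i)) ∧ eqFin (π s) (π (firstOf i))) ≡ false
    lem s with toℕ s ℕ.<ᵇ toℕ (firstOf i) in eqs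
    ... | false = P.refl
    ... | true = eqFin-false (λ e → ℕP.<⇒≱ (<ᵇ-elim eqs) (firstOf-least i s (P.trans e (π-firstOf i))))

  firstOf-isFirst : ∀ r → isFirst r ≡ true → firstOf (π r) ≡ r
  firstOf-isFirst r h = FinP.toℕ-injective (ℕP.≤-antisym (firstOf-least (π r) r P.refl) (ℕP.≮⇒≥ lem))
    where
    lem : toℕ (firstOf (π r)) < toℕ r → ⊥
    lem lt = true≢false (anyFin-intro k _ (firstOf (π r)) (∧-intro (<ᵇ-intro lt) (eqFin-intro (π-firstOf (π r))))) (not-elim h)

  firstOf-mono : ∀ i j → toℕ i < toℕ j → toℕ (firstOf i) < toℕ (firstOf j)
  firstOf-mono i j lt = ℕP.≰⇒> (λ le → ℕP.<⇒≱ lt (P.subst₂ _≤_ (P.cong toℕ (π-firstOf j)) (P.cong toℕ (π-firstOf i)) (mono _ _ le)))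

  firstOf-mono-≤ : ∀ i j → toℕ i ≤ toℕ j → toℕ (firstOf i) ≤ toℕ (firstOf j)
  firstOf-mono-≤ i j le with ℕP.m≤n⇒m<n∨m≡n le
  ... | inj₁ lt = ℕP.<⇒≤ (firstOf-mono i j lt)
  ... | inj₂ i≡j = ℕP.≤-reflexive (P.cong (toℕ ∘ firstOf) (FinP.toℕ-injective i≡j))

  firstOf-cancel-≤ : ∀ i j → toℕ (firstOf i) ≤ toℕ (firstOf j) → toℕ i ≤ toℕ j
  firstOf-cancel-≤ i j le = P.subst₂ _≤_ (P.cong toℕ (π-firstOf i)) (P.cong toℕ (π-firstOf j)) (mono _ _ le)

  isFirst-0 : ∀ r → toℕ r ≡ 0 → isFirst r ≡ true
  isFirst-0 r e0 = not-intro (anyFin-false k _ (λ s → lem s))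
    where
    lem : ∀ s → ((toℕ s ℕ.<ᵇ toℕ r) ∧ eqFin (π s) (π r)) ≡ false
    lem s with toℕ s ℕ.<ᵇ toℕ r in eqs
    ... | false = P.refl
    ... | true = ⊥-elim (ℕP.n≮0 (P.subst (toℕ s <_) e0 (<ᵇ-elim eqs)))

  NoFirstBetween : Fin k → Fin k → Set
  NoFirstBetween x r = ∀ l → isFirst l ≡ true → toℕ x < toℕ l → toℕ l ≤ toℕ r → ⊥

  π⇒betweenFirsts : ∀ I r → π r ≡ I → (toℕ (firstOf I) ≤ toℕ r) × NoFirstBetween (firstOf I) r
  π⇒betweenFirsts I r e = firstOf-least I r e , gap
    where
    gap : NoFirstBetween (firstOf I) r
    gap l fl lt le = ℕP.<⇒≢ lt (P.cong toℕ (P.trans (P.cong firstOf (P.sym πl)) (firstOf-isFirst l fl)))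
      where
      πl : π l ≡ I
      πl = FinP.toℕ-injective (ℕP.≤-antisym (P.subst (toℕ (π l) ≤_) (P.cong toℕ e) (mono l r le))
                                           (P.subst (_≤ toℕ (π l)) (P.cong toℕ (π-firstOf I)) (mono (firstOf I) l (ℕP.<⇒≤ lt))))

  betweenFirsts⇒π : ∀ I r → toℕ (firstOf I) ≤ toℕ r → NoFirstBetween (firstOf I) r → π r ≡ I
  betweenFirsts⇒π I r le gap = FinP.toℕ-injective (ℕP.≤-antisym (ℕP.≮⇒≥ lem) (P.subst (_≤ toℕ (π r)) (P.cong toℕ (π-firstOf I)) (mono _ _ le)))
    where
    lem : toℕ I < toℕ (π r) → ⊥
    lem lt = gap (firstOf (π r)) (isFirst-firstOf (π r)) (firstOf-mono I (π r) lt) (firstOf-least (π r) r P.refl)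

unpinch : ∀ {m} → Fin m → Fin m → Fin (suc m)
unpinch i = Fin.punchIn (Fin.suc i)

pinch-unpinch : ∀ {m} (i r : Fin m) → Fin.pinch i (unpinch i r) ≡ r
pinch-unpinch Fin.zero Fin.zero = P.refl
pinch-unpinch Fin.zero (Fin.suc r) = P.refl
pinch-unpinch (Fin.suc i) Fin.zero = P.refl
pinch-unpinch (Fin.suc i) (Fin.suc r) = P.cong Fin.suc (pinch-unpinch i r)

unpinch-pinch : ∀ {m} (i : Fin m) s → ¬ (s ≡ Fin.suc i) → unpinch i (Fin.pinch i s) ≡ s
unpinch-pinch Fin.zero Fin.zero ne = P.refl
unpinch-pinch Fin.zero (Fin.suc Fin.zero) ne = ⊥-elim (ne P.refl)
unpinch-pinch Fin.zero (Fin.suc (Fin.suc s)) ne = P.refl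
unpinch-pinch (Fin.suc i) Fin.zero ne = P.refl
unpinch-pinch (Fin.suc i) (Fin.suc s) ne = P.cong Fin.suc (unpinch-pinch i s (ne ∘ P.cong Fin.suc))

pinch-inject₁ : ∀ {m} (i : Fin m) → Fin.pinch i (inject₁ i) ≡ i
pinch-inject₁ Fin.zero = P.refl
pinch-inject₁ (Fin.suc i) = P.cong Fin.suc (pinch-inject₁ i)

pinch-suc : ∀ {m} (i : Fin m) → Fin.pinch i (Fin.suc i) ≡ i
pinch-suc Fin.zero = P.refl
pinch-suc (Fin.suc i) = P.cong Fin.suc (pinch-suc i)

unpinch-self : ∀ {m} (i : Fin m) → unpinch i i ≡ inject₁ i
unpinch-self Fin.zero = P.refl
unpinch-self (Fin.suc i) = P.cong Fin.suc (unpinch-self i)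

-- Sums in a finite field

module FieldFacts (𝔽 : FiniteField) where
  open FiniteField 𝔽
  open import Relation.Binary.Reasoning.Setoid setoid
  open import Algebra.Properties.CommutativeSemigroup +-commutativeSemigroup using () renaming (interchange to +-interchange)

  [_]·_ : Bool → Carrier → Carrier
  [ true ]· x = x
  [ false ]· x = 0#

  Sum : ∀ k → (Fin k → Carrier) → Carrier
  Sum zero f = 0#
  Sum (suc k) f = f Fin.zero + Sum k (f ∘ Fin.suc)

  Sum-cong : ∀ k {f g : Fin k → Carrier} → (∀ i → f i ≈ g i) → Sum k f ≈ Sum k g
  Sum-cong zero h = refl
  Sum-cong (suc k) h = +-cong (h Fin.zero) (Sum-cong k (h ∘ Fin.suc))

  Sum-cong≡ : ∀ k {f g : Fin k → Carrier} → (∀ i → f i ≡ g i) → Sum k f ≈ Sum k g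
  Sum-cong≡ k h = Sum-cong k (λ i → reflexive (h i))

  Sum-+ : ∀ k (f g : Fin k → Carrier) → Sum k (λ i → f i + g i) ≈ Sum k f + Sum k g
  Sum-+ zero f g = sym (+-identityˡ 0#)
  Sum-+ (suc k) f g = trans (+-congˡ (Sum-+ k _ _)) (+-interchange _ _ _ _)

  Sum-*ˡ : ∀ k a (f : Fin k → Carrier) → a * Sum k f ≈ Sum k (λ i → a * f i)
  Sum-*ˡ zero a f = zeroʳ a
  Sum-*ˡ (suc k) a f = trans (distribˡ a _ _) (+-congˡ (Sum-*ˡ k a _))

  Sum-0 : ∀ k {f : Fin k → Carrier} → (∀ i → f i ≈ 0#) → Sum k f ≈ 0#
  Sum-0 zero h = refl
  Sum-0 (suc k) h = trans (+-cong (h Fin.zero) (Sum-0 k (h ∘ Fin.suc))) (+-identityˡ 0#)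

  Sum-swap : ∀ k l (f : Fin k → Fin l → Carrier) → Sum k (λ i → Sum l (f i)) ≈ Sum l (λ j → Sum k (λ i → f i j))
  Sum-swap zero l f = sym (Sum-0 l (λ _ → refl))
  Sum-swap (suc k) l f = begin
    Sum l (f Fin.zero) + Sum k (λ i → Sum l (f (Fin.suc i))) ≈⟨ +-congˡ (Sum-swap k l (f ∘ Fin.suc)) ⟩
    Sum l (f Fin.zero) + Sum l (λ j → Sum k (λ i → f (Fin.suc i) j)) ≈⟨ sym (Sum-+ l _ _) ⟩
    Sum l (λ j → Sum (suc k) (λ i → f i j)) ∎

  Sum-split : ∀ m n (f : Fin (m ℕ.+ n) → Carrier) → Sum (m ℕ.+ n) f ≈ Sum m (λ i → f (i ↑ˡ n)) + Sum n (λ j → f (m ↑ʳ j))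
  Sum-split zero n f = sym (+-identityˡ _)
  Sum-split (suc m) n f = trans (+-congˡ (Sum-split m n (f ∘ Fin.suc))) (sym (+-assoc _ _ _))

  ind-cong : ∀ b {x y} → x ≈ y → [ b ]· x ≈ [ b ]· y
  ind-cong true e = e
  ind-cong false e = refl

  ind-* : ∀ b x y → [ b ]· (x * y) ≈ x * ([ b ]· y)
  ind-* true x y = refl
  ind-* false x y = sym (zeroʳ x)

  ind-∧ : ∀ b c x → [ b ∧ c ]· x ≡ [ b ]· ([ c ]· x)
  ind-∧ true c x = P.refl
  ind-∧ false c x = P.refl

  Sum-deltaˡ : ∀ k (i : Fin k) (f : Fin k → Carrier) → Sum k (λ j → [ eqFin j i ]· f j) ≈ f i
  Sum-deltaˡ (suc k) Fin.zero f = trans (+-congˡ (Sum-0 k (λ _ → refl))) (+-identityʳ _)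
  Sum-deltaˡ (suc k) (Fin.suc i) f = trans (+-congʳ refl) (trans (+-identityˡ _) (trans (Sum-cong k lem) (Sum-deltaˡ k i (f ∘ Fin.suc))))
    where
    lem : ∀ j → [ eqFin (Fin.suc j) (Fin.suc i) ]· f (Fin.suc j) ≈ [ eqFin j i ]· f (Fin.suc j)
    lem j with j Fin.≟ i
    ... | yes _ = refl
    ... | no _ = refl

  Sum-deltaʳ : ∀ k (i : Fin k) (f : Fin k → Carrier) → Sum k (λ j → [ eqFin i j ]· f j) ≈ f i
  Sum-deltaʳ k i f = trans (Sum-cong≡ k lem) (Sum-deltaˡ k i f)
    where
    lem : ∀ j → [ eqFin i j ]· f j ≡ [ eqFin j i ]· f j
    lem j with i Fin.≟ j | j Fin.≟ i
    ... | yes _ | yes _ = P.refl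
    ... | no _ | no _ = P.refl
    ... | yes eqn | no n = ⊥-elim (n (P.sym eqn))
    ... | no n | yes eqn = ⊥-elim (n (P.sym eqn))

  #elts : ℕ
  #elts = length elements

  elt : Fin #elts → Carrier
  elt = lookup elements

  index₀ : Fin #elts
  index₀ = Any.index (complete 0#)

  eqElt : Carrier → Carrier → Bool
  eqElt x y = ⌊ x ≟ y ⌋

  index : Carrier → Fin #elts
  index x = firstOr (λ j → eqElt x (elt j)) index₀

  eqElt-elim : ∀ {x y} → eqElt x y ≡ true → x ≈ y
  eqElt-elim {x} {y} h with x ≟ y
  ... | yes q = q

  eqElt-intro : ∀ {x y} → x ≈ y → eqElt x y ≡ true
  eqElt-intro {x} {y} q with x ≟ y
  ... | yes _ = P.refl
  ... | no nq = ⊥-elim (nq q)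

  ≈elt-index : ∀ x → x ≈ elt (index x)
  ≈elt-index x = eqElt-elim (firstOr-holds (λ j → eqElt x (elt j)) index₀ (Any.index (complete x)) (eqElt-intro (lookup-index (complete x))))

  elt-index : ∀ x → elt (index x) ≈ x
  elt-index x = sym (≈elt-index x)

  index-cong : ∀ {x y} → x ≈ y → index x ≡ index y
  index-cong {x} {y} q = firstOr-cong _ _ index₀ lem
    where
    lem : ∀ j → eqElt x (elt j) ≡ eqElt y (elt j)
    lem j with x ≟ elt j | y ≟ elt j
    ... | yes _ | yes _ = P.refl
    ... | no _ | no _ = P.refl
    ... | yes a | no b = ⊥-elim (b (trans (sym q) a))
    ... | no a | yes b = ⊥-elim (a (trans q b))

  infixr 8 _×·_
  _×·_ : ℕ → Carrier → Carrier
  zero ×· x = 0#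
  suc k ×· x = x + k ×· x

  ×·-+ : ∀ a b x → (a ℕ.+ b) ×· x ≈ a ×· x + b ×· x
  ×·-+ zero b x = sym (+-identityˡ _)
  ×·-+ (suc a) b x = trans (+-congˡ (×·-+ a b x)) (sym (+-assoc _ _ _))

  ×·-1 : ∀ a x → a ×· x ≈ (a ×· 1#) * x
  ×·-1 zero x = sym (zeroˡ x)
  ×·-1 (suc a) x = trans (+-cong (sym (*-identityˡ x)) (×·-1 a x)) (sym (distribʳ x 1# (a ×· 1#)))

  ×·-0 : ∀ a → a ×· 0# ≈ 0#
  ×·-0 zero = refl
  ×·-0 (suc a) = trans (+-identityˡ _) (×·-0 a)

  ×·-* : ∀ a b x → (a ℕ.* b) ×· x ≈ a ×· (b ×· x)
  ×·-* zero b x = refl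
  ×·-* (suc a) b x = trans (×·-+ b (a ℕ.* b) x) (+-congˡ (×·-* a b x))

  ×·-cong : ∀ a {x y} → x ≈ y → a ×· x ≈ a ×· y
  ×·-cong zero q = refl
  ×·-cong (suc a) q = +-cong q (×·-cong a q)

  x+y≈y⇒x≈0 : ∀ x y → x + y ≈ y → x ≈ 0#
  x+y≈y⇒x≈0 x y h = begin
    x ≈⟨ sym (+-identityʳ x) ⟩
    x + 0# ≈⟨ +-congˡ (sym (-‿inverseʳ y)) ⟩
    x + (y + - y) ≈⟨ sym (+-assoc x y (- y)) ⟩
    (x + y) + - y ≈⟨ +-congʳ h ⟩
    y + - y ≈⟨ -‿inverseʳ y ⟩
    0# ∎

  -- Pigeonhole on 0 ×· 1#, …, #elts ×· 1# gives i < j with i ×· 1# ≈ j ×· 1#, so (j ∸ i) ×· 1# ≈ 0#.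
  private
    char-exists : ∃[ d ] (suc d ×· 1# ≈ 0#)
    char-exists with FinP.pigeonhole (ℕP.n<1+n #elts) (λ (k : Fin (suc #elts)) → index (toℕ k ×· 1#))
    ... | i , j , i<j , eqij = ℕ.pred dd , lem2
      where
      dd : ℕ
      dd = toℕ j ∸ toℕ i
      jdd : toℕ j ≡ dd ℕ.+ toℕ i
      jdd = P.sym (ℕP.m∸n+n≡m (ℕP.<⇒≤ i<j))
      dpos : dd ≡ suc (ℕ.pred dd)
      dpos = P.sym (ℕP.suc-pred dd {{ℕ.>-nonZero (ℕP.m<n⇒0<n∸m i<j)}})
      eqv : toℕ i ×· 1# ≈ toℕ j ×· 1#
      eqv = trans (≈elt-index _) (trans (reflexive (P.cong elt eqij)) (elt-index _))
      lem : dd ×· 1# ≈ 0#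
      lem = x+y≈y⇒x≈0 _ (toℕ i ×· 1#) (trans (sym (×·-+ dd (toℕ i) 1#)) (trans (reflexive (P.cong (_×· 1#) (P.sym jdd))) (sym eqv)))
      lem2 : suc (ℕ.pred dd) ×· 1# ≈ 0#
      lem2 = trans (reflexive (P.cong (_×· 1#) (P.sym dpos))) lem

  char-1 : ℕ
  char-1 = proj₁ char-exists

  -- A positive multiple of the characteristic, which is all that counting modulo needs.
  char : ℕ
  char = suc char-1

  char×·≈0 : ∀ x → char ×· x ≈ 0#
  char×·≈0 x = trans (×·-1 char x) (trans (*-congʳ (proj₂ char-exists)) (zeroˡ x))

  ×·-mod-char : ∀ a x → a ×· x ≈ (a % char) ×· x
  ×·-mod-char a x = begin
    a ×· x ≈⟨ reflexive (P.cong (_×· x) (m≡m%n+[m/n]*n a char)) ⟩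
    (a % char ℕ.+ (a / char) ℕ.* char) ×· x ≈⟨ ×·-+ (a % char) ((a / char) ℕ.* char) x ⟩
    (a % char) ×· x + ((a / char) ℕ.* char) ×· x ≈⟨ +-congˡ (trans (×·-* (a / char) char x) (trans (×·-cong (a / char) (char×·≈0 x)) (×·-0 (a / char)))) ⟩
    (a % char) ×· x + 0# ≈⟨ +-identityʳ _ ⟩
    (a % char) ×· x ∎

  ind-Sum : ∀ b k (f : Fin k → Carrier) → [ b ]· Sum k f ≈ Sum k (λ i → [ b ]· f i)
  ind-Sum true k f = refl
  ind-Sum false k f = sym (Sum-0 k (λ _ → refl))

  fromBool : Bool → ℕ
  fromBool b = if b then 1 else 0

  fromBool-×· : ∀ b x → fromBool b ×· x ≈ [ b ]· x
  fromBool-×· true x = +-identityʳ x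
  fromBool-×· false x = refl

  Sum-by-value : ∀ K (p : Fin K → Bool) (h : Fin K → Carrier) →
    Sum K (λ x → [ p x ]· h x) ≈ Sum #elts (λ t → countFin K (λ x → p x ∧ eqFin (index (h x)) t) ×· elt t)
  Sum-by-value zero p h = sym (Sum-0 #elts (λ _ → refl))
  Sum-by-value (suc K) p h = begin
    [ b₀ ]· h₀ + Sum K (λ x → [ p (Fin.suc x) ]· h (Fin.suc x))
      ≈⟨ +-cong head (Sum-by-value K (p ∘ Fin.suc) (h ∘ Fin.suc)) ⟩
    Sum #elts (λ t → fromBool (c₀ t) ×· elt t) + Sum #elts (λ t → cK t ×· elt t)
      ≈⟨ sym (Sum-+ #elts _ _) ⟩
    Sum #elts (λ t → fromBool (c₀ t) ×· elt t + cK t ×· elt t)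
      ≈⟨ Sum-cong #elts (λ t → sym (×·-+ (fromBool (c₀ t)) (cK t) (elt t))) ⟩
    Sum #elts (λ t → countFin (suc K) (λ x → p x ∧ eqFin (index (h x)) t) ×· elt t) ∎
    where
    b₀ : Bool
    b₀ = p Fin.zero
    h₀ : Carrier
    h₀ = h Fin.zero
    c₀ : Fin #elts → Bool
    c₀ t = b₀ ∧ eqFin (index h₀) t
    cK : Fin #elts → ℕ
    cK t = countFin K (λ x → p (Fin.suc x) ∧ eqFin (index (h (Fin.suc x))) t)
    head : [ b₀ ]· h₀ ≈ Sum #elts (λ t → fromBool (c₀ t) ×· elt t)
    head = begin
      [ b₀ ]· h₀
        ≈⟨ ind-cong b₀ (≈elt-index h₀) ⟩
      [ b₀ ]· elt (index h₀)
        ≈⟨ ind-cong b₀ (sym (Sum-deltaʳ #elts (index h₀) elt)) ⟩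
      [ b₀ ]· Sum #elts (λ t → [ eqFin (index h₀) t ]· elt t)
        ≈⟨ ind-Sum b₀ #elts _ ⟩
      Sum #elts (λ t → [ b₀ ]· ([ eqFin (index h₀) t ]· elt t))
        ≈⟨ Sum-cong #elts (λ t → trans (reflexive (P.sym (ind-∧ b₀ _ (elt t)))) (sym (fromBool-×· (c₀ t) (elt t)))) ⟩
      Sum #elts (λ t → fromBool (c₀ t) ×· elt t) ∎

  Sum-by-value-mod : ∀ K (p : Fin K → Bool) (h : Fin K → Carrier) →
    Sum K (λ x → [ p x ]· h x) ≈ Sum #elts (λ t → (countFin K (λ x → p x ∧ eqFin (index (h x)) t) % char) ×· elt t)
  Sum-by-value-mod K p h = trans (Sum-by-value K p h) (Sum-cong #elts (λ t → ×·-mod-char (countFin K (λ x → p x ∧ eqFin (index (h x)) t)) (elt t)))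

-- Linear minors as contractions

module Contraction (𝔽 : FiniteField) where
  open FiniteField 𝔽
  open FieldFacts 𝔽
  open Matrices 𝔽
  open import Relation.Binary.Reasoning.Setoid setoid

  weight : ∀ {m} → Fin m → Carrier → Carrier → Fin (suc m) → Carrier
  weight Fin.zero α β Fin.zero = α
  weight Fin.zero α β (Fin.suc Fin.zero) = β
  weight Fin.zero α β (Fin.suc (Fin.suc r)) = 1#
  weight (Fin.suc i) α β Fin.zero = 1#
  weight (Fin.suc i) α β (Fin.suc r) = weight i α β r

  weight-other : ∀ {m} (i : Fin m) α β s → ¬ (s ≡ inject₁ i) → ¬ (s ≡ Fin.suc i) → weight i α β s ≡ 1#
  weight-other Fin.zero α β Fin.zero n1 n2 = ⊥-elim (n1 P.refl)
  weight-other Fin.zero α β (Fin.suc Fin.zero) n1 n2 = ⊥-elim (n2 P.refl)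
  weight-other Fin.zero α β (Fin.suc (Fin.suc s)) n1 n2 = P.refl
  weight-other (Fin.suc i) α β Fin.zero n1 n2 = P.refl
  weight-other (Fin.suc i) α β (Fin.suc s) n1 n2 = weight-other i α β s (n1 ∘ P.cong Fin.suc) (n2 ∘ P.cong Fin.suc)

  weight-inject₁ : ∀ {m} (i : Fin m) α β → weight i α β (inject₁ i) ≡ α
  weight-inject₁ Fin.zero α β = P.refl
  weight-inject₁ (Fin.suc i) α β = weight-inject₁ i α β

  weight-suc : ∀ {m} (i : Fin m) α β → weight i α β (Fin.suc i) ≡ β
  weight-suc Fin.zero α β = P.refl
  weight-suc (Fin.suc i) α β = weight-suc i α β

  merge : ∀ {m} → Fin m → Carrier → Carrier → (Fin (suc m) → Carrier) → Fin m → Carrier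
  merge Fin.zero α β v Fin.zero = α * v Fin.zero + β * v (Fin.suc Fin.zero)
  merge Fin.zero α β v (Fin.suc r) = v (Fin.suc (Fin.suc r))
  merge (Fin.suc i) α β v Fin.zero = v Fin.zero
  merge (Fin.suc i) α β v (Fin.suc r) = merge i α β (v ∘ Fin.suc) r

  rowSum-merge : ∀ {m n} (i : Fin m) α β (M : Matrix (suc m) n) r c → rowSum i α β M r c ≡ merge i α β (λ r' → M r' c) r
  rowSum-merge Fin.zero α β M Fin.zero c = P.refl
  rowSum-merge Fin.zero α β M (Fin.suc r) c = P.refl
  rowSum-merge (Fin.suc i) α β M Fin.zero c = P.refl
  rowSum-merge (Fin.suc i) α β M (Fin.suc r) c with Fin.compare r i | rowSum-merge i α β (λ r' → M (Fin.suc r')) r c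
  ... | Fin.less _ _ | ih = ih
  ... | Fin.equal _ | ih = ih
  ... | Fin.greater _ _ | ih = ih

  colSum-merge : ∀ {m n} (j : Fin n) α β (M : Matrix m (suc n)) r c → colSum j α β M r c ≡ merge j α β (M r) c
  colSum-merge Fin.zero α β M r Fin.zero = P.refl
  colSum-merge Fin.zero α β M r (Fin.suc c) = P.refl
  colSum-merge (Fin.suc j) α β M r Fin.zero = P.refl
  colSum-merge (Fin.suc j) α β M r (Fin.suc c) with Fin.compare c j | colSum-merge j α β (λ r' c' → M r' (Fin.suc c')) r c
  ... | Fin.less _ _ | ih = ih
  ... | Fin.equal _ | ih = ih
  ... | Fin.greater _ _ | ih = ih

  pushforward : ∀ {k k'} → (Fin k → Fin k') → (Fin k → Carrier) → (Fin k → Carrier) → Fin k' → Carrier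
  pushforward {k} π a v i = Sum k (λ r → [ eqFin (π r) i ]· (a r * v r))

  pushforward-cong : ∀ {k k'} {π π' : Fin k → Fin k'} {a a' v v' : Fin k → Carrier} →
    (∀ r → π r ≡ π' r) → (∀ r → a r ≈ a' r) → (∀ r → v r ≈ v' r) → ∀ i → pushforward π a v i ≈ pushforward π' a' v' i
  pushforward-cong {k} {π = π} {π'} {a} {a'} {v} {v'} hπ ha hv i = Sum-cong k
      (λ r → P.subst (λ z → [ eqFin (π r) i ]· (a r * v r) ≈ [ eqFin z i ]· (a' r * v' r)) (hπ r) (ind-cong (eqFin (π r) i) (*-cong (ha r) (hv r))))

  pushforward-congᵛ : ∀ {k k'} (π : Fin k → Fin k') (a : Fin k → Carrier)
      {v v' : Fin k → Carrier} → (∀ r → v r ≈ v' r) → ∀ i → pushforward π a v i ≈ pushforward π a v' i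
  pushforward-congᵛ π a hv i = pushforward-cong {π = π} {π} {a} {a} (λ _ → P.refl) (λ _ → refl) hv i

  ind-+ : ∀ b x y → [ b ]· (x + y) ≈ [ b ]· x + [ b ]· y
  ind-+ true x y = refl
  ind-+ false x y = sym (+-identityˡ 0#)

  pushforward-merge : ∀ {m m'} (i : Fin m) α β (π : Fin m → Fin m') a v j →
    pushforward π a (merge i α β v) j ≈ pushforward (π ∘ Fin.pinch i) (λ r → a (Fin.pinch i r) * weight i α β r) v j
  pushforward-merge {suc m₁} Fin.zero α β π a v j = begin
    [ b ]· (a0 * (α * v Fin.zero + β * v (Fin.suc Fin.zero))) + R1
      ≈⟨ +-cong first (Sum-cong m₁ (λ r → ind-cong (eqFin (π (Fin.suc r)) j) (*-congʳ (sym (*-identityʳ _))))) ⟩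
    ([ b ]· ((a0 * α) * v Fin.zero) + [ b ]· ((a0 * β) * v (Fin.suc Fin.zero))) + R2
      ≈⟨ +-assoc _ _ _ ⟩
    [ b ]· ((a0 * α) * v Fin.zero) + ([ b ]· ((a0 * β) * v (Fin.suc Fin.zero)) + R2) ∎
    where
    b : Bool
    b = eqFin (π Fin.zero) j
    a0 : Carrier
    a0 = a Fin.zero
    R1 R2 : Carrier
    R1 = Sum m₁ (λ r → [ eqFin (π (Fin.suc r)) j ]· (a (Fin.suc r) * v (Fin.suc (Fin.suc r))))
    R2 = Sum m₁ (λ r → [ eqFin (π (Fin.suc r)) j ]· ((a (Fin.suc r) * 1#) * v (Fin.suc (Fin.suc r))))
    first : [ b ]· (a0 * (α * v Fin.zero + β * v (Fin.suc Fin.zero))) ≈ [ b ]· ((a0 * α) * v Fin.zero) + [ b ]· ((a0 * β) * v (Fin.suc Fin.zero))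
    first = trans (ind-cong b (trans (distribˡ a0 _ _) (+-cong (sym (*-assoc _ _ _)) (sym (*-assoc _ _ _))))) (ind-+ b _ _)
  pushforward-merge {suc m₁} (Fin.suc i) α β π a v j =
    +-cong (ind-cong (eqFin (π Fin.zero) j) (*-congʳ (sym (*-identityʳ _))))
           (pushforward-merge i α β (π ∘ Fin.suc) (a ∘ Fin.suc) (v ∘ Fin.suc) j)

  swapMul : ∀ a α x → a * (α * x) ≈ α * (a * x)
  swapMul a α x = trans (sym (*-assoc a α x)) (trans (*-congʳ (*-comm a α)) (*-assoc α a x))

  merge-pushforward : ∀ {k k' n} (π : Fin k → Fin k') a (V : Fin k → Fin (suc n) → Carrier) (j : Fin n) α β I c →
    pushforward π a (λ r → merge j α β (V r) c) I ≈ merge j α β (λ c' → pushforward π a (λ r → V r c') I) c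
  merge-pushforward {k} π a V Fin.zero α β I Fin.zero = begin
    Sum k (λ r → [ eqFin (π r) I ]· (a r * (α * V r Fin.zero + β * V r (Fin.suc Fin.zero))))
      ≈⟨ Sum-cong k term ⟩
    Sum k (λ r → α * ([ eqFin (π r) I ]· (a r * V r Fin.zero)) + β * ([ eqFin (π r) I ]· (a r * V r (Fin.suc Fin.zero))))
      ≈⟨ Sum-+ k _ _ ⟩
    Sum k (λ r → α * ([ eqFin (π r) I ]· (a r * V r Fin.zero))) + Sum k (λ r → β * ([ eqFin (π r) I ]· (a r * V r (Fin.suc Fin.zero))))
      ≈⟨ +-cong (sym (Sum-*ˡ k α _)) (sym (Sum-*ˡ k β _)) ⟩
    α * pushforward π a (λ r → V r Fin.zero) I + β * pushforward π a (λ r → V r (Fin.suc Fin.zero)) I ∎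
    where
    term : ∀ r → [ eqFin (π r) I ]· (a r * (α * V r Fin.zero + β * V r (Fin.suc Fin.zero))) ≈
                 α * ([ eqFin (π r) I ]· (a r * V r Fin.zero)) + β * ([ eqFin (π r) I ]· (a r * V r (Fin.suc Fin.zero)))
    term r = trans (ind-cong (eqFin (π r) I) (trans (distribˡ (a r) _ _) (+-cong (swapMul _ _ _) (swapMul _ _ _))))
               (trans (ind-+ (eqFin (π r) I) _ _) (+-cong (ind-* (eqFin (π r) I) α _) (ind-* (eqFin (π r) I) β _)))
  merge-pushforward π a V Fin.zero α β I (Fin.suc c) = refl
  merge-pushforward π a V (Fin.suc j) α β I Fin.zero = refl
  merge-pushforward π a V (Fin.suc j) α β I (Fin.suc c) = merge-pushforward π a (λ r → V r ∘ Fin.suc) j α β I c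

  contract : ∀ {m n m' n'} → (Fin m → Fin m') → (Fin n → Fin n') → (Fin m → Carrier) → (Fin n → Carrier) → Matrix m n → Matrix m' n'
  contract π σ a b M I J = pushforward σ b (λ c → pushforward π a (λ r → M r c) I) J

  contract-cong : ∀ {m n m' n'} {π π' : Fin m → Fin m'} {σ σ' : Fin n → Fin n'} {a a' b b'} {M M' : Matrix m n} →
    (∀ r → π r ≡ π' r) → (∀ c → σ c ≡ σ' c) → (∀ r → a r ≈ a' r) → (∀ c → b c ≈ b' c) → (∀ r c → M r c ≈ M' r c) →
    ∀ I J → contract π σ a b M I J ≈ contract π' σ' a' b' M' I J
  contract-cong hπ hσ ha hb hM I J = pushforward-cong hσ hb (λ c → pushforward-cong hπ ha (λ r → hM r c) I) J

  contract-rowSum : ∀ {m n m' n'} (i : Fin m) α β (π : Fin m → Fin m') (σ : Fin n → Fin n') a b (M : Matrix (suc m) n) I J →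
    contract π σ a b (rowSum i α β M) I J ≈ contract (π ∘ Fin.pinch i) σ (λ r → a (Fin.pinch i r) * weight i α β r) b M I J
  contract-rowSum i α β π σ a b M I J =
    pushforward-congᵛ σ b (λ c → trans (pushforward-congᵛ π a (λ r → reflexive (rowSum-merge i α β M r c)) I) (pushforward-merge i α β π a (λ r → M r c) I)) J

  contract-colSum : ∀ {m n m' n'} (j : Fin n) α β (π : Fin m → Fin m') (σ : Fin n → Fin n') a b (M : Matrix m (suc n)) I J →
    contract π σ a b (colSum j α β M) I J ≈ contract π (σ ∘ Fin.pinch j) a (λ c → b (Fin.pinch j c) * weight j α β c) M I J
  contract-colSum j α β π σ a b M I J = begin
    contract π σ a b (colSum j α β M) I J
      ≈⟨ pushforward-congᵛ σ b (λ c → trans (pushforward-congᵛ π a (λ r → reflexive (colSum-merge j α β M r c)) I) (merge-pushforward π a M j α β I c)) J ⟩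
    pushforward σ b (merge j α β (λ c' → pushforward π a (λ r → M r c') I)) J
      ≈⟨ pushforward-merge j α β σ b _ J ⟩
    contract π (σ ∘ Fin.pinch j) a (λ c → b (Fin.pinch j c) * weight j α β c) M I J ∎

  pushforward-id : ∀ {k} (v : Fin k → Carrier) I → pushforward (λ r → r) (λ _ → 1#) v I ≈ v I
  pushforward-id {k} v I = trans (Sum-cong k (λ r → ind-cong (eqFin r I) (*-identityˡ (v r)))) (Sum-deltaˡ k I v)

  contract-id : ∀ {m n} (M : Matrix m n) I J → contract (λ r → r) (λ c → c) (λ _ → 1#) (λ _ → 1#) M I J ≈ M I J
  contract-id M I J = trans (pushforward-id _ J) (pushforward-id (λ r → M r J) I)

  Monotone : ∀ {k k'} → (Fin k → Fin k') → Set
  Monotone π = ∀ r s → toℕ r ≤ toℕ s → toℕ (π r) ≤ toℕ (π s)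

  Onto : ∀ {k k'} → (Fin k → Fin k') → Set
  Onto π = ∀ i → ∃[ r ] (π r ≡ i)

  UnitOnSingletons : ∀ {k k'} → (Fin k → Fin k') → (Fin k → Carrier) → Set
  UnitOnSingletons π a = ∀ r → (∀ s → π s ≡ π r → s ≡ r) → a r ≈ 1#

  Admissible : ∀ {k k'} → (Fin k → Fin k') → (Fin k → Carrier) → Set
  Admissible π a = Monotone π × Onto π × UnitOnSingletons π a

  inject₁≢suc : ∀ {m} (i : Fin m) → ¬ (inject₁ i ≡ Fin.suc i)
  inject₁≢suc i q = ℕP.m≢1+n+m (toℕ i) {0} (P.trans (P.sym (FinP.toℕ-inject₁ i)) (P.cong toℕ q))

  Admissible-pinch : ∀ {m m'} (i : Fin m) α β (π : Fin m → Fin m') a → Admissible π a → Admissible (π ∘ Fin.pinch i) (λ r → a (Fin.pinch i r) * weight i α β r)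
  Admissible-pinch i α β π a (mo , su , si) = mo' , su' , si'
    where
    mo' : Monotone (π ∘ Fin.pinch i)
    mo' r s le = mo _ _ (FinP.pinch-mono-≤ i le)
    su' : Onto (π ∘ Fin.pinch i)
    su' j with su j
    ... | r , eqn = unpinch i r , P.trans (P.cong π (pinch-unpinch i r)) eqn
    si' : UnitOnSingletons (π ∘ Fin.pinch i) (λ r → a (Fin.pinch i r) * weight i α β r)
    si' s h = trans (*-cong (si (Fin.pinch i s) h1) (reflexive (weight-other i α β s n1 n2))) (*-identityˡ 1#)
      where
      n1 : ¬ (s ≡ inject₁ i)
      n1 eqn = inject₁≢suc i
          (P.trans (P.sym eqn) (P.sym (h (Fin.suc i) (P.cong π (P.trans (pinch-suc i) (P.trans (P.sym (pinch-inject₁ i)) (P.cong (Fin.pinch i) (P.sym eqn))))))))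
      n2 : ¬ (s ≡ Fin.suc i)
      n2 eqn = inject₁≢suc i (P.trans (h (inject₁ i) (P.cong π (P.trans (pinch-inject₁ i) (P.trans (P.sym (pinch-suc i)) (P.cong (Fin.pinch i) (P.sym eqn)))))) eqn)
      h1 : ∀ r' → π r' ≡ π (Fin.pinch i s) → r' ≡ Fin.pinch i s
      h1 r' eqn = P.trans (P.sym (pinch-unpinch i r')) (P.cong (Fin.pinch i) (h (unpinch i r') (P.trans (P.cong π (pinch-unpinch i r')) eqn)))

  Admissible-id : ∀ {k} → Admissible (λ (r : Fin k) → r) (λ _ → 1#)
  Admissible-id = (λ r s le → le) , (λ i → i , P.refl) , (λ r _ → refl)

  ContractionOf : ∀ {m n m' n'} → Matrix m' n' → Matrix m n → Set
  ContractionOf {m} {n} {m'} {n'} N M = Σ (Fin m → Fin m') λ π → Σ (Fin n → Fin n') λ σ → Σ (Fin m → Carrier) λ a → Σ (Fin n → Carrier) λ b →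
    Admissible π a × Admissible σ b × (∀ I J → N I J ≈ contract π σ a b M I J)

  linearMinor⇒contraction : ∀ {m n m' n'} {N : Matrix m' n'} {M : Matrix m n} → LinearMinor N M → ContractionOf N M
  linearMinor⇒contraction {M = M} (done h) = (λ r → r) , (λ c → c) , (λ _ → 1#) , (λ _ → 1#)
      , Admissible-id , Admissible-id , λ I J → trans (h I J) (sym (contract-id M I J))
  linearMinor⇒contraction {M = M} (rowStep i α β linearMinor) with linearMinor⇒contraction linearMinor
  ... | π , σ , a , b , gπ , gσ , h =
    (π ∘ Fin.pinch i) , σ , (λ r → a (Fin.pinch i r) * weight i α β r) , b , Admissible-pinch i α β π a gπ , gσ ,
    λ I J → trans (h I J) (contract-rowSum i α β π σ a b M I J)
  linearMinor⇒contraction {M = M} (colStep j α β linearMinor) with linearMinor⇒contraction linearMinor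
  ... | π , σ , a , b , gπ , gσ , h =
    π , (σ ∘ Fin.pinch j) , a , (λ c → b (Fin.pinch j c) * weight j α β c) , gπ , Admissible-pinch j α β σ b gσ ,
    λ I J → trans (h I J) (contract-colSum j α β π σ a b M I J)

  unmergeWeight : ∀ {m} (i : Fin m) (a : Fin (suc m) → Carrier) → Fin m → Carrier
  unmergeWeight i a r with r Fin.≟ i
  ... | yes _ = 1#
  ... | no _ = a (unpinch i r)

  admissible-unmerge : ∀ {m k'} (π : Fin (suc m) → Fin k') a (i : Fin m) → π (inject₁ i) ≡ π (Fin.suc i) → Admissible π a →
    Admissible (π ∘ unpinch i) (unmergeWeight i a) × (∀ s → π (unpinch i (Fin.pinch i s)) ≡ π s) ×
    (∀ s → unmergeWeight i a (Fin.pinch i s) * weight i (a (inject₁ i)) (a (Fin.suc i)) s ≈ a s)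
  admissible-unmerge π a i hπ (mo , su , si) = (mo' , su' , si') , h1 , h2
    where
    h1 : ∀ s → π (unpinch i (Fin.pinch i s)) ≡ π s
    h1 s with s Fin.≟ Fin.suc i
    ... | yes P.refl = P.trans (P.cong π (P.trans (P.cong (unpinch i) (pinch-suc i)) (unpinch-self i))) hπ
    ... | no ne = P.cong π (unpinch-pinch i s ne)
    h2 : ∀ s → unmergeWeight i a (Fin.pinch i s) * weight i (a (inject₁ i)) (a (Fin.suc i)) s ≈ a s
    h2 s with s Fin.≟ inject₁ i | s Fin.≟ Fin.suc i
    ... | yes P.refl | _ rewrite pinch-inject₁ i | weight-inject₁ i (a (inject₁ i)) (a (Fin.suc i)) with i Fin.≟ i
    ...   | yes _ = *-identityˡ _
    ...   | no n = ⊥-elim (n P.refl)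
    h2 s | no _ | yes P.refl rewrite pinch-suc i | weight-suc i (a (inject₁ i)) (a (Fin.suc i)) with i Fin.≟ i
    ...   | yes _ = *-identityˡ _
    ...   | no n = ⊥-elim (n P.refl)
    h2 s | no n1 | no n2 rewrite weight-other i (a (inject₁ i)) (a (Fin.suc i)) s n1 n2 with Fin.pinch i s Fin.≟ i
    ...   | yes eqn = ⊥-elim (n1 (P.trans (P.sym (unpinch-pinch i s n2)) (P.trans (P.cong (unpinch i) eqn) (unpinch-self i))))
    ...   | no _ = trans (*-identityʳ _) (reflexive (P.cong a (unpinch-pinch i s n2)))
    mo' : Monotone (π ∘ unpinch i)
    mo' r s le = mo _ _ (FinP.punchIn-mono-≤ (Fin.suc i) r s le)
    su' : Onto (π ∘ unpinch i)
    su' j with su j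
    ... | s , eqn = Fin.pinch i s , P.trans (h1 s) eqn
    si' : UnitOnSingletons (π ∘ unpinch i) (unmergeWeight i a)
    si' r h with r Fin.≟ i
    ... | yes _ = refl
    ... | no rni = si (unpinch i r) h'
      where
      h' : ∀ s → π s ≡ π (unpinch i r) → s ≡ unpinch i r
      h' s eqn with s Fin.≟ Fin.suc i
      ... | yes P.refl = ⊥-elim (rni (P.sym (P.trans (P.sym (pinch-suc i)) (h (Fin.pinch i (Fin.suc i)) (P.trans (h1 (Fin.suc i)) eqn)))))
      ... | no ne = P.trans (P.sym (unpinch-pinch i s ne)) (P.cong (unpinch i) (h (Fin.pinch i s) (P.trans (h1 s) eqn)))

  noMerge⇒fixes< : ∀ {m m'} (π : Fin m → Fin m') → Monotone π → Onto π → (∀ r s → toℕ s ≡ suc (toℕ r) → ¬ π r ≡ π s) →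
         ∀ k r → toℕ r ≡ k → toℕ (π r) ≡ k
  noMerge⇒fixes< π mo su cd zero r eqn with su (zeroOf (π r))
  ... | s , es = ℕP.n≤0⇒n≡0 (ℕP.≤-trans (mo r s (P.subst (_≤ toℕ s) (P.sym eqn) z≤n)) (ℕP.≤-reflexive (P.trans (P.cong toℕ es) (toℕ-zeroOf (π r)))))
  noMerge⇒fixes< {m} {m'} π mo su cd (suc k) r eqn = ℕP.≤-antisym upper lower
    where
    k<m : k < m
    k<m = ℕP.<-trans (P.subst (k <_) (P.sym eqn) (ℕP.n<1+n k)) (FinP.toℕ<n r)
    r₀ : Fin m
    r₀ = Fin.fromℕ< k<m
    tr₀ : toℕ r₀ ≡ k
    tr₀ = FinP.toℕ-fromℕ< k<m
    ih : toℕ (π r₀) ≡ k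
    ih = noMerge⇒fixes< π mo su cd k r₀ tr₀
    lower : suc k ≤ toℕ (π r)
    lower = ℕP.≤∧≢⇒< (P.subst (_≤ toℕ (π r)) ih (mo r₀ r (P.subst (_≤ toℕ r) (P.sym tr₀) (ℕP.≤-trans (ℕP.n≤1+n k) (ℕP.≤-reflexive (P.sym eqn))))))
              (λ q → cd r₀ r (P.trans eqn (P.cong suc (P.sym tr₀))) (FinP.toℕ-injective (P.trans ih q)))
    upper : toℕ (π r) ≤ suc k
    upper with toℕ (π r) ℕP.≤? suc k
    ... | yes le = le
    ... | no gt = ⊥-elim (case (toℕ s ℕP.≤? k))
      where
      sk<m' : suc k < m'
      sk<m' = ℕP.<-trans (ℕP.≰⇒> gt) (FinP.toℕ<n (π r))
      v : Fin m'
      v = Fin.fromℕ< sk<m'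
      s : Fin m
      s = proj₁ (su v)
      tv : toℕ (π s) ≡ suc k
      tv = P.trans (P.cong toℕ (proj₂ (su v))) (FinP.toℕ-fromℕ< sk<m')
      case : Dec (toℕ s ≤ k) → ⊥
      case (yes le) = ℕP.<-irrefl P.refl
          (ℕP.≤-trans (ℕP.≤-reflexive (P.sym tv)) (ℕP.≤-trans (mo s r₀ (ℕP.≤-trans le (ℕP.≤-reflexive (P.sym tr₀)))) (ℕP.≤-reflexive ih)))
        where open import Data.Nat using (_<_)
      case (no nle) = ℕP.<-irrefl P.refl (ℕP.<-≤-trans (ℕP.≰⇒> gt) (ℕP.≤-trans (mo r s (ℕP.≤-trans (ℕP.≤-reflexive eqn) (ℕP.≰⇒> nle))) (ℕP.≤-reflexive tv)))

  noMerge⇒fixes : ∀ {m m'} (π : Fin m → Fin m') → Monotone π → Onto π → (∀ r s → toℕ s ≡ suc (toℕ r) → ¬ π r ≡ π s) →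
         ∀ r → toℕ (π r) ≡ toℕ r
  noMerge⇒fixes π mo su cd r = noMerge⇒fixes< π mo su cd (toℕ r) r P.refl

  onto-fixes⇒≡ : ∀ {m m'} (π : Fin m → Fin m') → Onto π → (∀ r → toℕ (π r) ≡ toℕ r) → m ≡ m'
  onto-fixes⇒≡ {m} {m'} π su fx = ℕP.≤-antisym (le1 m P.refl) (le2 m' P.refl)
    where
    le1 : ∀ k → k ≡ m → m ≤ m'
    le1 zero P.refl = z≤n
    le1 (suc k) P.refl = P.subst (λ z → suc z ≤ m') (P.trans (fx (Fin.fromℕ k)) (FinP.toℕ-fromℕ k)) (FinP.toℕ<n (π (Fin.fromℕ k)))
    le2 : ∀ k → k ≡ m' → m' ≤ m
    le2 zero P.refl = z≤n
    le2 (suc k) P.refl with su (Fin.fromℕ k)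
    ... | r , er = P.subst (λ z → suc z ≤ m) (P.trans (P.sym (fx r)) (P.trans (P.cong toℕ er) (FinP.toℕ-fromℕ k))) (FinP.toℕ<n r)

  noAdjacentMerge : ∀ {m k'} (π : Fin (suc m) → Fin k') → ¬ (∃[ i ] (π (inject₁ i) ≡ π (Fin.suc i))) →
    ∀ r s → toℕ s ≡ suc (toℕ r) → ¬ π r ≡ π s
  noAdjacentMerge π nm r Fin.zero () eqn
  noAdjacentMerge π nm r (Fin.suc s) ts eqn = nm (s , P.trans (P.cong π (FinP.toℕ-injective (P.trans (FinP.toℕ-inject₁ s) (ℕP.suc-injective ts)))) eqn)

  noAdjacentMerge-empty : ∀ {k'} (π : Fin 0 → Fin k') → ∀ r s → toℕ s ≡ suc (toℕ r) → ¬ π r ≡ π s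
  noAdjacentMerge-empty π ()

  contraction-id⇒linearMinor : ∀ {m n} {N M : Matrix m n} (π : Fin m → Fin m) (σ : Fin n → Fin n) a b → UnitOnSingletons π a → UnitOnSingletons σ b →
    (∀ r → toℕ (π r) ≡ toℕ r) → (∀ c → toℕ (σ c) ≡ toℕ c) → (∀ I J → N I J ≈ contract π σ a b M I J) → LinearMinor N M
  contraction-id⇒linearMinor {M = M} π σ a b sπ sσ fπ fσ h = done λ I J → trans (h I J) (trans (contract-cong fπ' fσ' aa bb (λ _ _ → refl) I J) (contract-id M I J))
    where
    fπ' : ∀ r → π r ≡ r
    fπ' r = FinP.toℕ-injective (fπ r)
    fσ' : ∀ c → σ c ≡ c
    fσ' c = FinP.toℕ-injective (fσ c)
    aa : ∀ r → a r ≈ 1#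
    aa r = sπ r (λ s eqn → FinP.toℕ-injective (P.trans (P.sym (fπ s)) (P.trans (P.cong toℕ eqn) (fπ r))))
    bb : ∀ c → b c ≈ 1#
    bb c = sσ c (λ s eqn → FinP.toℕ-injective (P.trans (P.sym (fσ s)) (P.trans (P.cong toℕ eqn) (fσ c))))

  NoAdjacentMerge : ∀ {k k'} → (Fin k → Fin k') → Set
  NoAdjacentMerge π = ∀ r s → toℕ s ≡ suc (toℕ r) → ¬ π r ≡ π s

  noMerge-contraction⇒linearMinor : ∀ {m n m' n'} {N : Matrix m' n'} {M : Matrix m n}
      (π : Fin m → Fin m') (σ : Fin n → Fin n') a b → Admissible π a → Admissible σ b →
    NoAdjacentMerge π → NoAdjacentMerge σ → (∀ I J → N I J ≈ contract π σ a b M I J) → LinearMinor N M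
  noMerge-contraction⇒linearMinor π σ a b (moπ , suπ , siπ) (moσ , suσ , siσ) cπ cσ h
    with onto-fixes⇒≡ π suπ (noMerge⇒fixes π moπ suπ cπ) | onto-fixes⇒≡ σ suσ (noMerge⇒fixes σ moσ suσ cσ)
  ... | P.refl | P.refl = contraction-id⇒linearMinor π σ a b siπ siσ (noMerge⇒fixes π moπ suπ cπ) (noMerge⇒fixes σ moσ suσ cσ) h

  contraction⇒linearMinor-cols : ∀ {m n m' n'} {N : Matrix m' n'} {M : Matrix m n} (π : Fin m → Fin m') (σ : Fin n → Fin n') a b → Admissible π a → Admissible σ b →
    NoAdjacentMerge π → (∀ I J → N I J ≈ contract π σ a b M I J) → LinearMinor N M
  contraction⇒linearMinor-cols {n = zero} π σ a b gπ gσ cπ h = noMerge-contraction⇒linearMinor π σ a b gπ gσ cπ (noAdjacentMerge-empty σ) h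
  contraction⇒linearMinor-cols {n = suc n₁} {N = N} {M = M} π σ a b gπ gσ cπ h with FinP.any? (λ j → σ (inject₁ j) Fin.≟ σ (Fin.suc j))
  ... | no nm = noMerge-contraction⇒linearMinor π σ a b gπ gσ cπ (noAdjacentMerge σ nm) h
  ... | yes (j , eqn) with admissible-unmerge σ b j eqn gσ
  ...   | gσ' , h1 , h2 = colStep j (b (inject₁ j)) (b (Fin.suc j)) (contraction⇒linearMinor-cols π (σ ∘ unpinch j) a (unmergeWeight j b) gπ gσ' cπ h')
    where
    h' : ∀ I J → N I J ≈ contract π (σ ∘ unpinch j) a (unmergeWeight j b) (colSum j (b (inject₁ j)) (b (Fin.suc j)) M) I J
    h' I J = trans (h I J)
        (trans (contract-cong {π = π} {σ = σ} {σ' = σ ∘ unpinch j ∘ Fin.pinch j} {a = a} {b = b}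
            {b' = λ c → unmergeWeight j b (Fin.pinch j c) * weight j (b (inject₁ j)) (b (Fin.suc j)) c} {M = M}
                                     (λ _ → P.refl) (λ c → P.sym (h1 c)) (λ _ → refl) (λ c → sym (h2 c)) (λ _ _ → refl) I J)
                                  (sym (contract-colSum j (b (inject₁ j)) (b (Fin.suc j)) π (σ ∘ unpinch j) a (unmergeWeight j b) M I J)))

  -- Whenever two adjacent rows share a block, undo their merge by one weighted sum; once no adjacent
  -- rows or columns share a block, π and σ are identities.
  contraction⇒linearMinor : ∀ {m n m' n'} {N : Matrix m' n'} {M : Matrix m n} (π : Fin m → Fin m') (σ : Fin n → Fin n') a b → Admissible π a → Admissible σ b →
    (∀ I J → N I J ≈ contract π σ a b M I J) → LinearMinor N M
  contraction⇒linearMinor {m = zero} π σ a b gπ gσ h = contraction⇒linearMinor-cols π σ a b gπ gσ (noAdjacentMerge-empty π) h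
  contraction⇒linearMinor {m = suc m₁} {N = N} {M = M} π σ a b gπ gσ h with FinP.any? (λ i → π (inject₁ i) Fin.≟ π (Fin.suc i))
  ... | no nm = contraction⇒linearMinor-cols π σ a b gπ gσ (noAdjacentMerge π nm) h
  ... | yes (i , eqn) with admissible-unmerge π a i eqn gπ
  ...   | gπ' , h1 , h2 = rowStep i (a (inject₁ i)) (a (Fin.suc i)) (contraction⇒linearMinor (π ∘ unpinch i) σ (unmergeWeight i a) b gπ' gσ h')
    where
    h' : ∀ I J → N I J ≈ contract (π ∘ unpinch i) σ (unmergeWeight i a) b (rowSum i (a (inject₁ i)) (a (Fin.suc i)) M) I J
    h' I J = trans (h I J)
        (trans (contract-cong {π = π} {π' = π ∘ unpinch i ∘ Fin.pinch i} {σ = σ} {a = a}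
            {a' = λ r → unmergeWeight i a (Fin.pinch i r) * weight i (a (inject₁ i)) (a (Fin.suc i)) r} {b = b} {M = M}
                                     (λ r → P.sym (h1 r)) (λ _ → P.refl) (λ r → sym (h2 r)) (λ _ → refl) (λ _ _ → refl) I J)
                                  (sym (contract-rowSum i (a (inject₁ i)) (a (Fin.suc i)) (π ∘ unpinch i) σ (unmergeWeight i a) b M I J)))

  Sum-rows-cols-swap : ∀ {m n} (P : Fin m → Bool) (Q : Fin n → Bool) (a : Fin m → Carrier) (b : Fin n → Carrier) (M : Matrix m n) →
    Sum m (λ r → [ P r ]· (a r * Sum n (λ c → [ Q c ]· (b c * M r c)))) ≈ Sum n (λ c → [ Q c ]· (b c * Sum m (λ r → [ P r ]· (a r * M r c))))
  Sum-rows-cols-swap {m} {n} P Q a b M = begin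
    Sum m (λ r → [ P r ]· (a r * Sum n (λ c → [ Q c ]· (b c * M r c))))
      ≈⟨ Sum-cong m (λ r → trans (ind-cong (P r) (Sum-*ˡ n (a r) _)) (ind-Sum (P r) n _)) ⟩
    Sum m (λ r → Sum n (λ c → [ P r ]· (a r * ([ Q c ]· (b c * M r c)))))
      ≈⟨ Sum-swap m n _ ⟩
    Sum n (λ c → Sum m (λ r → [ P r ]· (a r * ([ Q c ]· (b c * M r c)))))
      ≈⟨ Sum-cong n (λ c → Sum-cong m (λ r → term (P r) (Q c) (a r) (b c) (M r c))) ⟩
    Sum n (λ c → Sum m (λ r → [ Q c ]· (b c * ([ P r ]· (a r * M r c)))))
      ≈⟨ Sum-cong n (λ c → sym (trans (ind-cong (Q c) (Sum-*ˡ m (b c) _)) (ind-Sum (Q c) m _))) ⟩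
    Sum n (λ c → [ Q c ]· (b c * Sum m (λ r → [ P r ]· (a r * M r c)))) ∎
    where
    term : ∀ p q x y w → [ p ]· (x * ([ q ]· (y * w))) ≈ [ q ]· (y * ([ p ]· (x * w)))
    term true true x y w = swapMul x y w
    term true false x y w = zeroʳ x
    term false true x y w = sym (zeroʳ y)
    term false false x y w = refl

  blockSum≈contract : ∀ {m n m' n'} (π : Fin m → Fin m') (σ : Fin n → Fin n') a b (M : Matrix m n) (P : Fin m → Bool) (Q : Fin n → Bool) I J →
    (∀ r → P r ≡ eqFin (π r) I) → (∀ c → Q c ≡ eqFin (σ c) J) →
    Sum m (λ r → [ P r ]· (a r * Sum n (λ c → [ Q c ]· (b c * M r c)))) ≈ contract π σ a b M I J
  blockSum≈contract {m} {n} π σ a b M P Q I J hP hQ = trans (Sum-rows-cols-swap P Q a b M)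
    (trans (Sum-cong n (λ c → reflexive (P.cong (λ q → [ q ]· (b c * Sum m (λ r → [ P r ]· (a r * M r c)))) (hQ c))))
     (Sum-cong n (λ c → ind-cong (eqFin (σ c) J) (*-congˡ (Sum-cong m (λ r → reflexive (P.cong (λ q → [ q ]· (a r * M r c)) (hP r))))))))

-- FO+MOD formulas

module FormulaCombinators (σ : Signature) where
  ⊤F : ∀ {k} → Formula σ k
  ⊤F = all (eq Fin.zero Fin.zero)

  ⊥F : ∀ {k} → Formula σ k
  ⊥F = neg ⊤F

  guard : ∀ {k} → Bool → Formula σ k
  guard true = ⊤F
  guard false = ⊥F

  bigOr : ∀ {k} N → (Fin N → Formula σ k) → Formula σ k
  bigOr zero φ = ⊥F
  bigOr (suc N) φ = disj (φ Fin.zero) (bigOr N (φ ∘ Fin.suc))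

  bigAnd : ∀ {k} N → (Fin N → Formula σ k) → Formula σ k
  bigAnd zero φ = ⊤F
  bigAnd (suc N) φ = conj (φ Fin.zero) (bigAnd N (φ ∘ Fin.suc))

  module _ (A : Structure σ) where
    eval-⊤ : ∀ {k} (ρ : Fin k → Fin (size A)) → eval A ⊤F ρ ≡ true
    eval-⊤ ρ = allFin-intro (size A) _ (λ x → ==F-refl x)

    eval-⊥ : ∀ {k} (ρ : Fin k → Fin (size A)) → eval A ⊥F ρ ≡ false
    eval-⊥ ρ = P.cong not (eval-⊤ ρ)

    eval-guard : ∀ {k} b (ρ : Fin k → Fin (size A)) → eval A (guard b) ρ ≡ b
    eval-guard true ρ = eval-⊤ ρ
    eval-guard false ρ = eval-⊥ ρ

    eval-bigOr : ∀ {k} N (φ : Fin N → Formula σ k) ρ → eval A (bigOr N φ) ρ ≡ anyFin N (λ j → eval A (φ j) ρ)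
    eval-bigOr zero φ ρ = eval-⊥ ρ
    eval-bigOr (suc N) φ ρ = P.cong (eval A (φ Fin.zero) ρ ∨_) (eval-bigOr N (φ ∘ Fin.suc) ρ)

    eval-bigAnd : ∀ {k} N (φ : Fin N → Formula σ k) ρ → eval A (bigAnd N φ) ρ ≡ allFin N (λ j → eval A (φ j) ρ)
    eval-bigAnd zero φ ρ = eval-⊤ ρ
    eval-bigAnd (suc N) φ ρ = P.cong (eval A (φ Fin.zero) ρ ∧_) (eval-bigAnd N (φ ∘ Fin.suc) ρ)

module ModCounting (𝔽 : FiniteField) (σ : Signature) where
  open FiniteField 𝔽
  open FieldFacts 𝔽
  open FormulaCombinators σ
  open import Relation.Binary.Reasoning.Setoid setoid

  -- weightedCountIs l φ g w expresses that weightedCount l φ g ≈ elt w (below).  Since 𝔽 and the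
  -- residues modulo char are finite, it can guess the first residue q and the value elt w' of the rest.
  weightedCountIs-step : ∀ {k} (l : ℕ) → (Fin (suc l) → Formula σ (suc k)) → (Fin (suc l) → Carrier) → Fin #elts → Fin char → Fin #elts → Formula σ k

  weightedCountIs : ∀ {k} (l : ℕ) → (Fin l → Formula σ (suc k)) → (Fin l → Carrier) → Fin #elts → Formula σ k
  weightedCountIs zero φ g w = guard (eqElt (elt w) 0#)
  weightedCountIs (suc l) φ g w = bigOr char (λ q → bigOr #elts (weightedCountIs-step l φ g w q))

  weightedCountIs-step l φ g w q w' = conj (guard (eqElt (elt w) (toℕ q ×· g Fin.zero + elt w')))
         (conj (exMod (toℕ q) char-1 (φ Fin.zero)) (weightedCountIs l (φ ∘ Fin.suc) (g ∘ Fin.suc) w'))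

  module _ (A : Structure σ) where
    count : ∀ {k} → Formula σ (suc k) → (Fin k → Fin (size A)) → ℕ
    count φ ρ = countFin (size A) (λ x → eval A φ (extend x ρ))

    weightedCount : ∀ {k} (l : ℕ) → (Fin l → Formula σ (suc k)) → (Fin l → Carrier) → (Fin k → Fin (size A)) → Carrier
    weightedCount l φ g ρ = Sum l (λ t → (count (φ t) ρ % char) ×· g t)

    weightedCountIs-sound : ∀ {k} l φ g w (ρ : Fin k → Fin (size A)) → eval A (weightedCountIs l φ g w) ρ ≡ true → weightedCount l φ g ρ ≈ elt w
    weightedCountIs-sound zero φ g w ρ h = sym (eqElt-elim (P.trans (P.sym (eval-guard A _ ρ)) h))
    weightedCountIs-sound (suc l) φ g w ρ h
      with anyFin-elim char (λ q → eval A (bigOr #elts (weightedCountIs-step l φ g w q)) ρ) (P.trans (P.sym (eval-bigOr A char (λ q → bigOr #elts (weightedCountIs-step l φ g w q)) ρ)) h)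
    ... | q , hq with anyFin-elim #elts (λ w' → eval A (weightedCountIs-step l φ g w q w') ρ) (P.trans (P.sym (eval-bigOr A #elts (weightedCountIs-step l φ g w q) ρ)) hq)
    ...   | w' , hw' with ∧₃-elim (eval A (guard (eqElt (elt w) (toℕ q ×· g Fin.zero + elt w'))) ρ) (eval A (exMod (toℕ q) char-1 (φ Fin.zero)) ρ) (eval A (weightedCountIs l (φ ∘ Fin.suc) (g ∘ Fin.suc) w') ρ) hw'
    ...     | hw1 , hw2 , hw3 = begin
      (count (φ Fin.zero) ρ % char) ×· g Fin.zero + weightedCount l (φ ∘ Fin.suc) (g ∘ Fin.suc) ρ
        ≈⟨ +-cong (reflexive (P.cong (_×· g Fin.zero) cq)) (weightedCountIs-sound l (φ ∘ Fin.suc) (g ∘ Fin.suc) w' ρ hw3) ⟩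
      toℕ q ×· g Fin.zero + elt w' ≈⟨ sym (eqElt-elim (P.trans (P.sym (eval-guard A _ ρ)) hw1)) ⟩
      elt w ∎
      where
      cq : count (φ Fin.zero) ρ % char ≡ toℕ q
      cq = P.trans (==ℕ-elim hw2) (m<n⇒m%n≡m (FinP.toℕ<n q))

    weightedCountIs-complete : ∀ {k} l φ g w (ρ : Fin k → Fin (size A)) → weightedCount l φ g ρ ≈ elt w → eval A (weightedCountIs l φ g w) ρ ≡ true
    weightedCountIs-complete zero φ g w ρ h = P.trans (eval-guard A _ ρ) (eqElt-intro (sym h))
    weightedCountIs-complete (suc l) φ g w ρ h =
      P.trans (eval-bigOr A char (λ q → bigOr #elts (weightedCountIs-step l φ g w q)) ρ) (anyFin-intro char (λ q → eval A (bigOr #elts (weightedCountIs-step l φ g w q)) ρ) q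
        (P.trans (eval-bigOr A #elts (weightedCountIs-step l φ g w q) ρ) (anyFin-intro #elts (λ w' → eval A (weightedCountIs-step l φ g w q w') ρ) w'
          (∧-intro (P.trans (eval-guard A (eqElt (elt w) (toℕ q ×· g Fin.zero + elt w')) ρ) (eqElt-intro gd))
            (∧-intro (==ℕ-intro (P.trans (P.sym tq) (P.sym (m<n⇒m%n≡m (FinP.toℕ<n q)))))
                     (weightedCountIs-complete l (φ ∘ Fin.suc) (g ∘ Fin.suc) w' ρ (≈elt-index _)))))))
      where
      c0 : ℕ
      c0 = count (φ Fin.zero) ρ
      q : Fin char
      q = Fin.fromℕ< (m%n<n c0 char)
      tq : toℕ q ≡ c0 % char
      tq = FinP.toℕ-fromℕ< (m%n<n c0 char)
      rest : Carrier
      rest = weightedCount l (φ ∘ Fin.suc) (g ∘ Fin.suc) ρ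
      w' : Fin #elts
      w' = index rest
      gd : elt w ≈ toℕ q ×· g Fin.zero + elt w'
      gd = trans (sym h) (+-cong (reflexive (P.cong (_×· g Fin.zero) (P.sym tq))) (≈elt-index rest))

pair : ∀ {k} → Fin k → Fin k → Fin 2 → Fin k
pair x y Fin.zero = x
pair x y (Fin.suc _) = y

-- The transduction

module Transducer (𝔽 : FiniteField) where
  open FiniteField 𝔽
  open FieldFacts 𝔽
  open Matrices 𝔽

  -- Colour 0 marks block starts (the first row and the first column always start a block); colour
  -- suc t on a row or column gives it the weight elt t.  The least such t wins, and the weight is 1
  -- when there is no such colour or the block is a singleton.
  #colours : ℕ
  #colours = suc #elts

  Sig₊ : Signature
  Sig₊ = MSig ⊕ #colours

  open FormulaCombinators Sig₊ public
  open ModCounting 𝔽 Sig₊ public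

  F : ℕ → Set
  F k = Formula Sig₊ k

  z : ∀ {k} → Fin (suc k)
  z = Fin.zero
  s : ∀ {k} → Fin k → Fin (suc k)
  s = Fin.suc

  rowF : ∀ {k} → Fin k → F k
  rowF v = atom (inj₁ row) (λ _ → v)
  leF : ∀ {k} → Fin k → Fin k → F k
  leF v w = atom (inj₁ leq) (pair v w)
  ltF : ∀ {k} → Fin k → Fin k → F k
  ltF v w = neg (leF w v)
  colF : ∀ {k} → Fin #colours → Fin k → F k
  colF j v = atom (inj₂ j) (λ _ → v)
  EF : ∀ {k} (a : Carrier) → ¬ (a ≈ 0#) → Fin k → Fin k → F k
  EF a p v w = atom (inj₁ (E (a , p))) (pair v w)

  sameF : ∀ {k} → Fin k → Fin k → F k
  sameF v w = disj (conj (rowF v) (rowF w)) (conj (neg (rowF v)) (neg (rowF w)))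
  startF : ∀ {k} → Fin k → F k
  startF v = disj (colF z v) (neg (ex (conj (sameF z (s v)) (ltF z (s v)))))
  inBlockF : ∀ {k} → Fin k → Fin k → F k
  inBlockF x r = conj (sameF x r) (conj (leF x r) (neg (ex (conj (startF z) (conj (sameF z (s x)) (conj (ltF (s x) z) (leF z (s r))))))))
  singletonF : ∀ {k} → Fin k → F k
  singletonF v = neg (ex (conj (ltF (s v) z) (inBlockF (s v) z)))

  index1 : Fin #elts
  index1 = index 1#

  colourIsF : ∀ {k} → Fin #elts → Fin k → F k
  colourIsF t v = disj (conj (bigAnd #elts (λ j → disj (guard (not (toℕ j <ᵇ toℕ t))) (neg (colF (s j) v)))) (colF (s t) v))
                    (conj (bigAnd #elts (λ j → neg (colF (s j) v))) (guard (eqFin t index1)))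
  singletonBlockF : ∀ {k} → Fin k → F k
  singletonBlockF v = conj (startF v) (singletonF v)
  coefIsF : ∀ {k} → Fin #elts → Fin k → F k
  coefIsF t v = disj (conj (singletonBlockF v) (guard (eqFin t index1))) (conj (neg (singletonBlockF v)) (colourIsF t v))

  entryIsNonzeroF' : ∀ {k} (x : Carrier) → Dec (x ≈ 0#) → Fin k → Fin k → F k
  entryIsNonzeroF' x (yes _) r c = ⊥F
  entryIsNonzeroF' x (no p) r c = EF x p r c
  entryIsNonzeroF : ∀ {k} → Fin #elts → Fin k → Fin k → F k
  entryIsNonzeroF t r c = entryIsNonzeroF' (elt t) (elt t ≟ 0#) r c

  -- A zero entry is the absence of every E-relation.
  entryIsF : ∀ {k} → Fin #elts → Fin k → Fin k → F k
  entryIsF u r c = if eqElt (elt u) 0# then bigAnd #elts (λ t → neg (entryIsNonzeroF t r c)) else entryIsNonzeroF u r c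

  coefTimesEntryIsF : ∀ {k} → Fin #elts → Fin k → Fin k → F k
  coefTimesEntryIsF t c r = bigOr #elts (λ a → bigOr #elts (λ u → conj (guard (eqFin (index (elt a * elt u)) t)) (conj (coefIsF a c) (entryIsF u r c))))

  innerSumIsF : ∀ {k} → Fin k → Fin k → Fin #elts → F k
  innerSumIsF r y w = weightedCountIs #elts (λ t → conj (inBlockF (s y) z) (coefTimesEntryIsF t z (s r))) elt w

  coefTimesInnerIsF : ∀ {k} → Fin #elts → Fin k → Fin k → F k
  coefTimesInnerIsF t r y = bigOr #elts (λ a → bigOr #elts (λ w → conj (guard (eqFin (index (elt a * elt w)) t)) (conj (coefIsF a r) (innerSumIsF r y w))))

  blockValueIsF : ∀ {k} → Fin k → Fin k → Fin #elts → F k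
  blockValueIsF x y u = weightedCountIs #elts (λ t → conj (inBlockF (s x) z) (coefTimesInnerIsF t z (s y))) elt u

  ρ-entry : (a : Carrier) → ¬ (a ≈ 0#) → F 2
  ρ-entry a p = conj (rowF z) (conj (neg (rowF (s z))) (bigOr #elts (λ u → conj (guard (eqElt (elt u) a)) (blockValueIsF z (s z) u))))

  ρ-Tlm : (R : MSym) → F (arity MSig R)
  ρ-Tlm row = rowF z
  ρ-Tlm leq = leF z (s z)
  ρ-Tlm (E (a , p)) = ρ-entry a p

  Tlm : Transduction MSig MSig
  Tlm = record { colours = #colours ; ν = startF z ; ρ = ρ-Tlm }

module Semantics (𝔽 : FiniteField) {m n : ℕ} (M : Matrices.Matrix 𝔽 m n) (c : Fin (Transducer.#colours 𝔽) → Fin (m ℕ.+ n) → Bool) where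
  open FiniteField 𝔽
  open FieldFacts 𝔽
  open Matrices 𝔽
  open Transducer 𝔽

  A : Structure Sig₊
  A = expand #colours (enc M) c

  K : ℕ
  K = m ℕ.+ n

  V : Set
  V = Fin K

  isRow : V → Bool
  isRow v = eval A (rowF {1} z) (λ _ → v)
  same : V → V → Bool
  same v w = eval A (sameF z (s z)) (pair v w)
  opaque
    start : V → Bool
    start v = eval A (startF {1} z) (λ _ → v)
    inBlock : V → V → Bool
    inBlock x v = eval A (inBlockF z (s z)) (pair x v)
    singleton : V → Bool
    singleton v = eval A (singletonF {1} z) (λ _ → v)

  opaque
    unfolding start inBlock singleton
    startF-sem : ∀ {k} (ρ : Fin k → V) x → eval A (startF x) ρ ≡ start (ρ x)
    startF-sem ρ x = P.refl
    inBlockF-sem : ∀ {k} (ρ : Fin k → V) x r → eval A (inBlockF x r) ρ ≡ inBlock (ρ x) (ρ r)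
    inBlockF-sem ρ x r = P.refl
    singletonF-sem : ∀ {k} (ρ : Fin k → V) x → eval A (singletonF x) ρ ≡ singleton (ρ x)
    singletonF-sem ρ x = P.refl

  isRow-↑ˡ : ∀ r → isRow (r ↑ˡ n) ≡ true
  isRow-↑ˡ r rewrite FinP.splitAt-↑ˡ m r n = P.refl

  isRow-↑ʳ : ∀ c' → isRow (m ↑ʳ c') ≡ false
  isRow-↑ʳ c' rewrite FinP.splitAt-↑ʳ m n c' = P.refl

  same-elim : ∀ v w → same v w ≡ true → isRow v ≡ isRow w
  same-elim v w h with isRow v | isRow w
  ... | true | true = P.refl
  ... | false | false = P.refl
  ... | true | false = ⊥-elim (true≢false h P.refl)
  ... | false | true = ⊥-elim (true≢false h P.refl)

  same-intro : ∀ v w → isRow v ≡ isRow w → same v w ≡ true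
  same-intro v w h with isRow v | isRow w
  ... | true | true = P.refl
  ... | false | false = P.refl
  ... | true | false = ⊥-elim (true≡false⇒⊥ h)
  ... | false | true = ⊥-elim (true≡false⇒⊥ (P.sym h))

  -- The rows (side = true, off = 0) or the columns (side = false, off = m) of the encoding.
  module Side (k off : ℕ) (emb : Fin k → V) (side : Bool) (emb-toℕ : ∀ i → toℕ (emb i) ≡ off ℕ.+ toℕ i)
              (emb-isRow : ∀ i → isRow (emb i) ≡ side) (onto : ∀ v → isRow v ≡ side → ∃[ i ] (emb i ≡ v)) where

    startᵢ : Fin k → Bool
    startᵢ i = start (emb i)

    inBlockᵢ : Fin k → Fin k → Bool
    inBlockᵢ i j = inBlock (emb i) (emb j)

    emb-mono-< : ∀ i j → toℕ i < toℕ j → toℕ (emb i) < toℕ (emb j)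
    emb-mono-< i j lt = P.subst₂ _<_ (P.sym (emb-toℕ i)) (P.sym (emb-toℕ j)) (ℕP.+-monoʳ-< off lt)

    emb-cancel-< : ∀ i j → toℕ (emb i) < toℕ (emb j) → toℕ i < toℕ j
    emb-cancel-< i j lt = ℕP.+-cancelˡ-< off _ _ (P.subst₂ _<_ (emb-toℕ i) (emb-toℕ j) lt)

    emb-mono-≤ : ∀ i j → toℕ i ≤ toℕ j → toℕ (emb i) ≤ toℕ (emb j)
    emb-mono-≤ i j le = P.subst₂ _≤_ (P.sym (emb-toℕ i)) (P.sym (emb-toℕ j)) (ℕP.+-monoʳ-≤ off le)

    emb-cancel-≤ : ∀ i j → toℕ (emb i) ≤ toℕ (emb j) → toℕ i ≤ toℕ j
    emb-cancel-≤ i j le = ℕP.+-cancelˡ-≤ off _ _ (P.subst₂ _≤_ (emb-toℕ i) (emb-toℕ j) le)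

    same-emb : ∀ v i → same v (emb i) ≡ true → ∃[ j ] (emb j ≡ v)
    same-emb v i h = onto v (P.trans (same-elim v (emb i) h) (emb-isRow i))

    earlier : V → Bool
    earlier w = anyFin K (λ x → same x w ∧ not (toℕ w ≤ᵇ toℕ x))

    opaque
      unfolding start
      start-unfold : ∀ w → start w ≡ (c Fin.zero w ∨ not (earlier w))
      start-unfold w = P.refl

    start-first : ∀ i → toℕ i ≡ 0 → startᵢ i ≡ true
    start-first i e0 = P.trans (start-unfold (emb i)) (∨-introʳ {c Fin.zero (emb i)} (not-intro (anyFin-false K _ lem)))
      where
      lem : ∀ x → (same x (emb i) ∧ not (toℕ (emb i) ≤ᵇ toℕ x)) ≡ false
      lem x = ∧-false-intro λ h → case (same-emb x i h)
        where
        case : ∃[ j ] (emb j ≡ x) → not (toℕ (emb i) ≤ᵇ toℕ x) ≡ false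
        case (j , P.refl) with toℕ (emb i) ≤ᵇ toℕ (emb j) in eq1
        ... | true = P.refl
        ... | false = ⊥-elim (true≢false (≤ᵇ-intro (emb-mono-≤ i j (P.subst (_≤ toℕ j) (P.sym e0) z≤n))) eq1)

    start-elim′ : ∀ i → (c Fin.zero (emb i) ∨ not (earlier (emb i))) ≡ true → c Fin.zero (emb i) ≡ true ⊎ toℕ i ≡ 0
    start-elim : ∀ i → startᵢ i ≡ true → c Fin.zero (emb i) ≡ true ⊎ toℕ i ≡ 0
    start-elim i h = start-elim′ i (P.trans (P.sym (start-unfold (emb i))) h)

    start-elim′ i h with c Fin.zero (emb i) in eqc
    ... | true = inj₁ P.refl
    ... | false with toℕ i in eqi
    ...   | zero = inj₂ P.refl
    ...   | suc t = ⊥-elim (true≢false wit (not-elim h))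
      where
      k>0 : 0 < k
      k>0 = ℕP.<-trans (P.subst (0 <_) (P.sym eqi) (s≤s z≤n)) (FinP.toℕ<n i)
      j0 : Fin k
      j0 = Fin.fromℕ< k>0
      wit : earlier (emb i) ≡ true
      wit = anyFin-intro K _ (emb j0) (∧-intro (same-intro (emb j0) (emb i) (P.trans (emb-isRow j0) (P.sym (emb-isRow i))))
              (not≤ᵇ-intro (emb-mono-< j0 i (P.subst₂ _<_ (P.sym (FinP.toℕ-fromℕ< k>0)) (P.sym eqi) (s≤s z≤n)))))

    between : V → V → Bool
    between x r = anyFin K (λ v → start v ∧ (same v x ∧ (not (toℕ v ≤ᵇ toℕ x) ∧ (toℕ v ≤ᵇ toℕ r))))

    opaque
      unfolding inBlock
      inBlock-unfold : ∀ x r → inBlock x r ≡ (same x r ∧ ((toℕ x ≤ᵇ toℕ r) ∧ not (between x r)))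
      inBlock-unfold x r = P.refl

    NoStartBetween : Fin k → Fin k → Set
    NoStartBetween i j = ∀ l → startᵢ l ≡ true → toℕ i < toℕ l → toℕ l ≤ toℕ j → ⊥

    inBlockᵢ-elim : ∀ i j → inBlockᵢ i j ≡ true → toℕ i ≤ toℕ j × NoStartBetween i j
    inBlockᵢ-elim i j h with ∧₃-elim (same (emb i) (emb j)) (toℕ (emb i) ≤ᵇ toℕ (emb j)) (not (between (emb i) (emb j))) (P.trans (P.sym (inBlock-unfold (emb i) (emb j))) h)
    ... | _ , h2 , h3 = emb-cancel-≤ i j (≤ᵇ-elim h2) , gap
      where
      gap : NoStartBetween i j
      gap l stl lt le = true≢false (anyFin-intro K _ (emb l) (∧-intro stl (∧-intro (same-intro (emb l) (emb i) (P.trans (emb-isRow l) (P.sym (emb-isRow i))))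
                 (∧-intro (not≤ᵇ-intro (emb-mono-< i l lt)) (≤ᵇ-intro (emb-mono-≤ l j le)))))) (not-elim h3)

    inBlockᵢ-intro : ∀ i j → toℕ i ≤ toℕ j → NoStartBetween i j → inBlockᵢ i j ≡ true
    inBlockᵢ-intro i j le gap = P.trans (inBlock-unfold (emb i) (emb j)) (∧-intro (same-intro (emb i) (emb j) (P.trans (emb-isRow i) (P.sym (emb-isRow j))))
                             (∧-intro (≤ᵇ-intro (emb-mono-≤ i j le)) (not-intro (anyFin-false K _ lem))))
      where
      lem : ∀ v → (start v ∧ (same v (emb i) ∧ (not (toℕ v ≤ᵇ toℕ (emb i)) ∧ (toℕ v ≤ᵇ toℕ (emb j))))) ≡ false
      lem v = ∧-false-intro λ sv → ∧-false-intro λ sm → case (same-emb v i sm) sv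
        where
        case : ∃[ l ] (emb l ≡ v) → start v ≡ true → (not (toℕ v ≤ᵇ toℕ (emb i)) ∧ (toℕ v ≤ᵇ toℕ (emb j))) ≡ false
        case (l , P.refl) sv = ∧-false-intro λ h1 → lem2 (toℕ (emb l) ≤ᵇ toℕ (emb j)) P.refl h1
          where
          lem2 : ∀ b → (toℕ (emb l) ≤ᵇ toℕ (emb j)) ≡ b → not (toℕ (emb l) ≤ᵇ toℕ (emb i)) ≡ true → b ≡ false
          lem2 false _ _ = P.refl
          lem2 true eb h1 = ⊥-elim (gap l sv (emb-cancel-< i l (not≤ᵇ-elim h1)) (emb-cancel-≤ l j (≤ᵇ-elim eb)))

    inBlock-otherSide : ∀ i v → ¬ (isRow v ≡ side) → inBlock (emb i) v ≡ false
    inBlock-otherSide i v h = P.trans (inBlock-unfold (emb i) v) (∧-false-intro λ sm → ⊥-elim (h (P.trans (P.sym (same-elim (emb i) v sm)) (emb-isRow i))))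

    opaque
      unfolding singleton
      singleton-unfold : ∀ v → singleton v ≡ not (anyFin K (λ w → not (toℕ w ≤ᵇ toℕ v) ∧ inBlock v w))
      singleton-unfold v = P.refl

    singleton-elim : ∀ r → singleton (emb r) ≡ true → ∀ j → toℕ r < toℕ j → inBlockᵢ r j ≡ false
    singleton-elim r h j lt with inBlockᵢ r j in eqj
    ... | false = P.refl
    ... | true = ⊥-elim (true≢false (anyFin-intro K _ (emb j) (∧-intro (not≤ᵇ-intro (emb-mono-< r j lt)) eqj))
        (not-elim (P.trans (P.sym (singleton-unfold (emb r))) h)))

    singleton-intro : ∀ r → (∀ j → toℕ r < toℕ j → inBlockᵢ r j ≡ false) → singleton (emb r) ≡ true
    singleton-intro r h = P.trans (singleton-unfold (emb r)) (not-intro (anyFin-false K _ lem))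
      where
      lem : ∀ w → (not (toℕ w ≤ᵇ toℕ (emb r)) ∧ inBlock (emb r) w) ≡ false
      lem w = ∧-false-intro λ lt → case (isRow w Data.Bool.≟ side) lt
        where
        case : Dec (isRow w ≡ side) → not (toℕ w ≤ᵇ toℕ (emb r)) ≡ true → inBlock (emb r) w ≡ false
        case (no ne) _ = inBlock-otherSide r w ne
        case (yes ye) lt with onto w ye
        ... | j , P.refl = h j (emb-cancel-< r j (not≤ᵇ-elim lt))

  colourIndex : V → Fin #elts
  colourIndex v = firstOr (λ j → c (Fin.suc j) v) index1

  singletonBlock : V → Bool
  singletonBlock v = start v ∧ singleton v

  coefIndex : V → Fin #elts
  coefIndex v = if singletonBlock v then index1 else colourIndex v

  coef : V → Carrier
  coef v = elt (coefIndex v)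

  colourIsF-sem : ∀ {k} (ρ : Fin k → V) t x → eval A (colourIsF t x) ρ ≡ eqFin (colourIndex (ρ x)) t
  colourIsF-sem {k} ρ t x = P.trans (P.cong₂ (λ a b → (a ∧ c (Fin.suc t) (ρ x)) ∨ b) e1 (P.cong₂ _∧_ e2 (eval-guard A (eqFin t index1) ρ)))
                           (eqFin-firstOr (λ j → c (Fin.suc j) (ρ x)) index1 t)
    where
    e1 : eval A (bigAnd #elts (λ j → disj (guard (not (toℕ j <ᵇ toℕ t))) (neg (colF (Fin.suc j) x))))
        ρ ≡ allFin #elts (λ j → not (toℕ j <ᵇ toℕ t) ∨ not (c (Fin.suc j) (ρ x)))
    e1 = P.trans (eval-bigAnd A #elts _ ρ) (allFin-cong #elts _ _ (λ j → P.cong (_∨ not (c (Fin.suc j) (ρ x))) (eval-guard A (not (toℕ j <ᵇ toℕ t)) ρ)))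
    e2 : eval A (bigAnd #elts (λ j → neg (colF (Fin.suc j) x))) ρ ≡ allFin #elts (λ j → not (c (Fin.suc j) (ρ x)))
    e2 = eval-bigAnd A #elts _ ρ

  coefIsF-sem : ∀ {k} (ρ : Fin k → V) t x → eval A (coefIsF t x) ρ ≡ eqFin (coefIndex (ρ x)) t
  coefIsF-sem ρ t x = P.trans (P.cong₂ (λ q b → (q ∧ eval A (guard (eqFin t index1)) ρ) ∨ (not q ∧ b)) ssE P.refl)
                      (P.trans (P.cong₂ (λ a b → (singletonBlock (ρ x) ∧ a) ∨ (not (singletonBlock (ρ x)) ∧ b)) (eval-guard A (eqFin t index1) ρ) (colourIsF-sem ρ t x)) (lem (singletonBlock (ρ x))))
    where
    ssE : eval A (singletonBlockF x) ρ ≡ singletonBlock (ρ x)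
    ssE = P.cong₂ _∧_ (startF-sem ρ x) (singletonF-sem ρ x)
    lem : ∀ b → ((b ∧ eqFin t index1) ∨ (not b ∧ eqFin (colourIndex (ρ x)) t)) ≡ eqFin (if b then index1 else colourIndex (ρ x)) t
    lem true = P.trans (Data.Bool.Properties.∨-identityʳ (eqFin t index1))
        (Bool-ext (λ h → eqFin-intro (P.sym (eqFin-elim h))) (λ h → eqFin-intro (P.sym (eqFin-elim h))))
    lem false = P.refl

  entry : V → V → Carrier
  entry v w with splitAt m v | splitAt m w
  ... | inj₁ r | inj₂ c' = M r c'
  ... | _ | _ = 0#

  entry-↑ : ∀ r c' → entry (r ↑ˡ n) (m ↑ʳ c') ≡ M r c'
  entry-↑ r c' rewrite FinP.splitAt-↑ˡ m r n | FinP.splitAt-↑ʳ m n c' = P.refl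

  eqElt-false : ∀ {x y} → ¬ (x ≈ y) → eqElt x y ≡ false
  eqElt-false {x} {y} ne with x ≟ y
  ... | yes q = ⊥-elim (ne q)
  ... | no _ = P.refl

  E-sem : ∀ {k} (ρ : Fin k → V) a p x y → eval A (EF a p x y) ρ ≡ eqElt (entry (ρ x) (ρ y)) a
  E-sem ρ a p x y with splitAt m (ρ x) | splitAt m (ρ y)
  ... | inj₁ r | inj₂ c' = P.refl
  ... | inj₁ r | inj₁ _ = P.sym (eqElt-false (λ q → p (sym q)))
  ... | inj₂ _ | inj₁ _ = P.sym (eqElt-false (λ q → p (sym q)))
  ... | inj₂ _ | inj₂ _ = P.sym (eqElt-false (λ q → p (sym q)))

  entryIsNonzeroF-sem : ∀ {k} (ρ : Fin k → V) t x y → eval A (entryIsNonzeroF t x y) ρ ≡ (not (eqElt (elt t) 0#) ∧ eqElt (entry (ρ x) (ρ y)) (elt t))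
  entryIsNonzeroF-sem ρ t x y with elt t ≟ 0#
  ... | yes _ = eval-⊥ A ρ
  ... | no p = E-sem ρ (elt t) p x y

  entryIsF-sem : ∀ {k} (ρ : Fin k → V) u x y → eval A (entryIsF u x y) ρ ≡ eqElt (entry (ρ x) (ρ y)) (elt u)
  entryIsF-sem ρ u x y with elt u ≟ 0#
  ... | no p = E-sem ρ (elt u) p x y
  ... | yes p0 = P.trans (P.trans (eval-bigAnd A #elts _ ρ) (allFin-cong #elts _ _ (λ t → P.cong not (entryIsNonzeroF-sem ρ t x y)))) (Bool-ext fwd bwd)
    where
    X : Carrier
    X = entry (ρ x) (ρ y)
    fwd : allFin #elts (λ t → not (not (eqElt (elt t) 0#) ∧ eqElt X (elt t))) ≡ true → eqElt X (elt u) ≡ true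
    fwd h with X ≟ 0#
    ... | yes x0 = eqElt-intro (trans x0 (sym p0))
    ... | no nx0 = ⊥-elim (true≢false (∧-intro (not-intro (eqElt-false (λ q → nx0 (trans (≈elt-index X) q)))) (eqElt-intro (≈elt-index X)))
        (not-elim (allFin-elim #elts _ h (index X))))
    bwd : eqElt X (elt u) ≡ true → allFin #elts (λ t → not (not (eqElt (elt t) 0#) ∧ eqElt X (elt t))) ≡ true
    bwd h = allFin-intro #elts _
        (λ t → not-intro (∧-false-intro (λ nz → eqElt-false (λ q → true≢false (eqElt-intro (trans (sym q) (trans (eqElt-elim h) p0))) (not-elim nz)))))

  any-product-index : ∀ (a₀ : Fin #elts) (X : Carrier) t →
    anyFin #elts (λ a → anyFin #elts (λ u → eqFin (index (elt a * elt u)) t ∧ (eqFin a₀ a ∧ eqElt X (elt u)))) ≡ eqFin (index (elt a₀ * X)) t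
  any-product-index a₀ X t = Bool-ext fwd bwd
    where
    lhs : Bool
    lhs = anyFin #elts (λ a → anyFin #elts (λ u → eqFin (index (elt a * elt u)) t ∧ (eqFin a₀ a ∧ eqElt X (elt u))))
    fwd : lhs ≡ true → eqFin (index (elt a₀ * X)) t ≡ true
    fwd h with anyFin-elim #elts _ h
    ... | a , ha with anyFin-elim #elts _ ha
    ...   | u , hu with ∧₃-elim (eqFin (index (elt a * elt u)) t) (eqFin a₀ a) (eqElt X (elt u)) hu
    ...     | h1 , h2 , h3 with eqFin-elim h2
    ...       | P.refl = eqFin-intro (P.trans (index-cong (*-congˡ (eqElt-elim h3))) (eqFin-elim h1))
    bwd : eqFin (index (elt a₀ * X)) t ≡ true → lhs ≡ true
    bwd h = anyFin-intro #elts _ a₀ (anyFin-intro #elts _ (index X)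
              (∧-intro (eqFin-intro (P.trans (index-cong (*-congˡ (elt-index X))) (eqFin-elim h)))
                (∧-intro (eqFin-intro P.refl) (eqElt-intro (≈elt-index X)))))

  coefTimesEntryIsF-sem : ∀ {k} (ρ : Fin k → V) t cv rv → eval A (coefTimesEntryIsF t cv rv) ρ ≡ eqFin (index (coef (ρ cv) * entry (ρ rv) (ρ cv))) t
  coefTimesEntryIsF-sem ρ t cv rv = P.trans (P.trans (eval-bigOr A #elts _ ρ) (anyFin-cong #elts _ _ λ a → P.trans (eval-bigOr A #elts _ ρ)
                        (anyFin-cong #elts _ _ λ u → P.cong₂ _∧_ (eval-guard A (eqFin (index (elt a * elt u)) t) ρ) (P.cong₂ _∧_ (coefIsF-sem ρ a cv) (entryIsF-sem ρ u rv cv)))))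
                       (any-product-index (coefIndex (ρ cv)) (entry (ρ rv) (ρ cv)) t)

  open import Relation.Binary.Reasoning.Setoid setoid

  opaque
    innerValue : V → V → Carrier
    innerValue v y = Sum K (λ w → [ inBlock y w ]· (coef w * entry v w))

  weightedCount≈Sum : ∀ {k} (ρ : Fin k → V) (φ : Fin #elts → F (suc k)) (p : V → Bool) (h : V → Carrier) →
    (∀ t x → eval A (φ t) (extend x ρ) ≡ (p x ∧ eqFin (index (h x)) t)) →
    weightedCount A #elts φ elt ρ ≈ Sum K (λ x → [ p x ]· h x)
  weightedCount≈Sum ρ φ p h hyp = sym (trans (Sum-by-value-mod K p h)
      (Sum-cong #elts (λ t → reflexive (P.cong (λ q → (q % char) ×· elt t) (countFin-cong K _ _ (λ x → P.sym (hyp t x)))))))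
    where open import Data.Nat.DivMod using (_%_)

  weightedCountIs-sem : ∀ {k} (ρ : Fin k → V) (φ : Fin #elts → F (suc k)) (p : V → Bool) (h : V → Carrier) →
    (∀ t x → eval A (φ t) (extend x ρ) ≡ (p x ∧ eqFin (index (h x)) t)) →
    ∀ w → eval A (weightedCountIs #elts φ elt w) ρ ≡ eqElt (Sum K (λ x → [ p x ]· h x)) (elt w)
  weightedCountIs-sem ρ φ p h hyp w = Bool-ext
    (λ q → eqElt-intro (trans (sym (weightedCount≈Sum ρ φ p h hyp)) (weightedCountIs-sound A #elts φ elt w ρ q)))
    (λ q → weightedCountIs-complete A #elts φ elt w ρ (trans (weightedCount≈Sum ρ φ p h hyp) (eqElt-elim q)))

  opaque
    unfolding innerValue
    innerSumIsF-sem : ∀ {k} (ρ : Fin k → V) r y w → eval A (innerSumIsF r y w) ρ ≡ eqElt (innerValue (ρ r) (ρ y)) (elt w)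
    innerSumIsF-sem ρ r y w = weightedCountIs-sem ρ _ (inBlock (ρ y)) (λ x → coef x * entry (ρ r) x)
      (λ t x → P.cong₂ _∧_ (inBlockF-sem (extend x ρ) (Fin.suc y) Fin.zero) (coefTimesEntryIsF-sem (extend x ρ) t Fin.zero (Fin.suc r))) w

  coefTimesInnerIsF-sem : ∀ {k} (ρ : Fin k → V) t r y → eval A (coefTimesInnerIsF t r y) ρ ≡ eqFin (index (coef (ρ r) * innerValue (ρ r) (ρ y))) t
  coefTimesInnerIsF-sem ρ t r y = P.trans (P.trans (eval-bigOr A #elts _ ρ) (anyFin-cong #elts _ _ λ a → P.trans (eval-bigOr A #elts _ ρ)
                        (anyFin-cong #elts _ _ λ w → P.cong₂ _∧_ (eval-guard A (eqFin (index (elt a * elt w)) t) ρ) (P.cong₂ _∧_ (coefIsF-sem ρ a r) (innerSumIsF-sem ρ r y w)))))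
                       (any-product-index (coefIndex (ρ r)) (innerValue (ρ r) (ρ y)) t)

  opaque
    blockValue : V → V → Carrier
    blockValue x y = Sum K (λ v → [ inBlock x v ]· (coef v * innerValue v y))

  opaque
    unfolding blockValue innerValue
    blockValueIsF-sem : ∀ {k} (ρ : Fin k → V) x y u → eval A (blockValueIsF x y u) ρ ≡ eqElt (blockValue (ρ x) (ρ y)) (elt u)
    blockValueIsF-sem ρ x y u = weightedCountIs-sem ρ _ (inBlock (ρ x)) (λ v → coef v * innerValue v (ρ y))
      (λ t v → P.cong₂ _∧_ (inBlockF-sem (extend v ρ) (Fin.suc x) Fin.zero) (coefTimesInnerIsF-sem (extend v ρ) t Fin.zero (Fin.suc y))) u

  ρ-entry-sem : ∀ (ρ : Fin 2 → V) a p → eval A (ρ-entry a p) ρ ≡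
      (isRow (ρ Fin.zero) ∧ (not (isRow (ρ (Fin.suc Fin.zero))) ∧ eqElt (blockValue (ρ Fin.zero) (ρ (Fin.suc Fin.zero))) a))
  ρ-entry-sem ρ a p = P.cong (λ b → isRow (ρ Fin.zero) ∧ (not (isRow (ρ (Fin.suc Fin.zero))) ∧ b))
    (P.trans (P.trans (eval-bigOr A #elts _ ρ) (anyFin-cong #elts _ _ (λ u → P.cong₂ _∧_ (eval-guard A (eqElt (elt u) a) ρ) (blockValueIsF-sem ρ Fin.zero (Fin.suc Fin.zero) u))))
      (Bool-ext fwd bwd))
    where
    X : Carrier
    X = blockValue (ρ Fin.zero) (ρ (Fin.suc Fin.zero))
    fwd : anyFin #elts (λ u → eqElt (elt u) a ∧ eqElt X (elt u)) ≡ true → eqElt X a ≡ true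
    fwd h with anyFin-elim #elts _ h
    ... | u , hu with ∧-elim (eqElt (elt u) a) (eqElt X (elt u)) hu
    ...   | h1 , h2 = eqElt-intro (trans (eqElt-elim h2) (eqElt-elim h1))
    bwd : eqElt X a ≡ true → anyFin #elts (λ u → eqElt (elt u) a ∧ eqElt X (elt u)) ≡ true
    bwd h = anyFin-intro #elts _ (index X) (∧-intro (eqElt-intro (trans (elt-index X) (eqElt-elim h))) (eqElt-intro (≈elt-index X)))

  ontoR : ∀ v → isRow v ≡ true → ∃[ i ] (i ↑ˡ n ≡ v)
  ontoR v h with splitView m n v
  ... | inj₁ (r , q) = r , P.sym q
  ... | inj₂ (c' , P.refl) = ⊥-elim (true≡false⇒⊥ (P.trans (P.sym h) (isRow-↑ʳ c')))

  ontoC : ∀ v → isRow v ≡ false → ∃[ i ] (m ↑ʳ i ≡ v)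
  ontoC v h with splitView m n v
  ... | inj₂ (c' , q) = c' , P.sym q
  ... | inj₁ (r , P.refl) = ⊥-elim (true≡false⇒⊥ (P.trans (P.sym (isRow-↑ˡ r)) h))

  module RS = Side m 0 (_↑ˡ n) true (λ i → FinP.toℕ-↑ˡ i n) isRow-↑ˡ ontoR
  module CS = Side n m (m ↑ʳ_) false (λ i → FinP.toℕ-↑ʳ m i) isRow-↑ʳ ontoC

  sum-rows : ∀ (x : Fin m) (f : V → Carrier) → Sum K (λ v → [ inBlock (x ↑ˡ n) v ]· f v) ≈ Sum m (λ r → [ RS.inBlockᵢ x r ]· f (r ↑ˡ n))
  sum-rows x f = trans (Sum-split m n _)
      (trans (+-congˡ (Sum-0 n (λ c' → reflexive (P.cong (λ b → [ b ]· f (m ↑ʳ c')) (RS.inBlock-otherSide x (m ↑ʳ c') (λ q → true≡false⇒⊥ (P.trans (P.sym q) (isRow-↑ʳ c')))))))) (+-identityʳ _))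

  sum-cols : ∀ (y : Fin n) (f : V → Carrier) → Sum K (λ v → [ inBlock (m ↑ʳ y) v ]· f v) ≈ Sum n (λ c' → [ CS.inBlockᵢ y c' ]· f (m ↑ʳ c'))
  sum-cols y f = trans (Sum-split m n _)
      (trans (+-congʳ (Sum-0 m (λ r → reflexive (P.cong (λ b → [ b ]· f (r ↑ˡ n)) (CS.inBlock-otherSide y (r ↑ˡ n) (λ q → true≡false⇒⊥ (P.trans (P.sym (isRow-↑ˡ r)) q))))))) (+-identityˡ _))

  rowCoef : Fin m → Carrier
  rowCoef r = coef (r ↑ˡ n)
  colCoef : Fin n → Carrier
  colCoef c' = coef (m ↑ʳ c')

  blockSum : Fin m → Fin n → Carrier
  blockSum x y = Sum m (λ r → [ RS.inBlockᵢ x r ]· (rowCoef r * Sum n (λ c' → [ CS.inBlockᵢ y c' ]· (colCoef c' * M r c'))))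

  opaque
    unfolding blockValue innerValue
    blockValue≈blockSum : ∀ x y → blockValue (x ↑ˡ n) (m ↑ʳ y) ≈ blockSum x y
    blockValue≈blockSum x y = trans (sum-rows x _) (Sum-cong m (λ r → ind-cong (RS.inBlockᵢ x r) (*-congˡ
      (trans (sum-cols y _) (Sum-cong n (λ c' → ind-cong (CS.inBlockᵢ y c') (*-congˡ (reflexive (entry-↑ r c')))))))))

module Correctness (𝔽 : FiniteField) where
  open FiniteField 𝔽
  open FieldFacts 𝔽
  open Matrices 𝔽
  open Contraction 𝔽
  open Transducer 𝔽

  eqElt-congˡ : ∀ {x y} a → x ≈ y → eqElt x a ≡ eqElt y a
  eqElt-congˡ {x} {y} a q = Bool-ext (λ h → eqElt-intro (trans (sym q) (eqElt-elim h))) (λ h → eqElt-intro (trans q (eqElt-elim h)))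

  encRow-↑ˡ : ∀ {m n} (N : Matrix m n) (i : Fin m) → encRel N row (λ _ → i ↑ˡ n) ≡ true
  encRow-↑ˡ {m} {n} N i rewrite FinP.splitAt-↑ˡ m i n = P.refl
  encRow-↑ʳ : ∀ {m n} (N : Matrix m n) (j : Fin n) → encRel N row (λ _ → m ↑ʳ j) ≡ false
  encRow-↑ʳ {m} {n} N j rewrite FinP.splitAt-↑ʳ m n j = P.refl

  encE-↑ˡ↑ʳ : ∀ {m n} (N : Matrix m n) a p (i : Fin m) (j : Fin n) → encRel N (E (a , p)) (pair (i ↑ˡ n) (m ↑ʳ j)) ≡ eqElt (N i j) a
  encE-↑ˡ↑ʳ {m} {n} N a p i j rewrite FinP.splitAt-↑ˡ m i n | FinP.splitAt-↑ʳ m n j = P.refl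
  encE-↑ˡ↑ˡ : ∀ {m n} (N : Matrix m n) a p (i i' : Fin m) → encRel N (E (a , p)) (pair (i ↑ˡ n) (i' ↑ˡ n)) ≡ false
  encE-↑ˡ↑ˡ {m} {n} N a p i i' rewrite FinP.splitAt-↑ˡ m i n | FinP.splitAt-↑ˡ m i' n = P.refl
  encE-↑ʳ : ∀ {m n} (N : Matrix m n) a p (j : Fin n) (k : Fin (m ℕ.+ n)) → encRel N (E (a , p)) (pair (m ↑ʳ j) k) ≡ false
  encE-↑ʳ {m} {n} N a p j k rewrite FinP.splitAt-↑ʳ m n j with splitAt m k
  ... | inj₁ _ = P.refl
  ... | inj₂ _ = P.refl

  encRow-unary : ∀ {m n} (N : Matrix m n) (t : Fin 1 → Fin (m ℕ.+ n)) → encRel N row t ≡ encRel N row (λ _ → t Fin.zero)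
  encRow-unary {m} N t with splitAt m (t Fin.zero)
  ... | inj₁ _ = P.refl
  ... | inj₂ _ = P.refl

  encE-binary : ∀ {m n} (N : Matrix m n) x (t : Fin 2 → Fin (m ℕ.+ n)) → encRel N (E x) t ≡ encRel N (E x) (pair (t Fin.zero) (t (Fin.suc Fin.zero)))
  encE-binary {m} N x t with splitAt m (t Fin.zero) | splitAt m (t (Fin.suc Fin.zero))
  ... | inj₁ _ | inj₁ _ = P.refl
  ... | inj₁ _ | inj₂ _ = P.refl
  ... | inj₂ _ | inj₁ _ = P.refl
  ... | inj₂ _ | inj₂ _ = P.refl

  ≤ᵇ-cong : ∀ {a a' b b' : ℕ} → a ≡ a' → b ≡ b' → (a ≤ᵇ b) ≡ (a' ≤ᵇ b')
  ≤ᵇ-cong P.refl P.refl = P.refl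

  ≤ᵇ-ext : ∀ {a b c d : ℕ} → (a ≤ b → c ≤ d) → (c ≤ d → a ≤ b) → (a ≤ᵇ b) ≡ (c ≤ᵇ d)
  ≤ᵇ-ext f g = Bool-ext (λ h → ≤ᵇ-intro (f (≤ᵇ-elim h))) (λ h → ≤ᵇ-intro (g (≤ᵇ-elim h)))

  module FromColouring {m n} (M : Matrix m n) (c : Fin #colours → Fin (m ℕ.+ n) → Bool) where
    open Semantics 𝔽 M c

    module RB = Blocks RS.startᵢ RS.start-first
    module CB = Blocks CS.startᵢ CS.start-first

    m' n' : ℕ
    m' = RB.#blocks
    n' = CB.#blocks

    opaque
      N : Matrix m' n'
      N = contract RB.blockOf CB.blockOf rowCoef colCoef M

    opaque
      unfolding N
      N-def : ∀ I J → N I J ≈ contract RB.blockOf CB.blockOf rowCoef colCoef M I J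
      N-def I J = refl

    rowBlock≡blockOf : ∀ I r → RS.inBlockᵢ (RB.blockStart I) r ≡ eqFin (RB.blockOf r) I
    rowBlock≡blockOf I r = Bool-ext (λ h → eqFin-intro
        (RB.between⇒blockOf I r (proj₁ (RS.inBlockᵢ-elim (RB.blockStart I) r h)) (proj₂ (RS.inBlockᵢ-elim (RB.blockStart I) r h))))
                        (λ h → RS.inBlockᵢ-intro (RB.blockStart I) r (proj₁ (RB.blockOf⇒between I r (eqFin-elim h))) (proj₂ (RB.blockOf⇒between I r (eqFin-elim h))))

    colBlock≡blockOf : ∀ J c' → CS.inBlockᵢ (CB.blockStart J) c' ≡ eqFin (CB.blockOf c') J
    colBlock≡blockOf J c' = Bool-ext (λ h → eqFin-intro
        (CB.between⇒blockOf J c' (proj₁ (CS.inBlockᵢ-elim (CB.blockStart J) c' h)) (proj₂ (CS.inBlockᵢ-elim (CB.blockStart J) c' h))))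
                        (λ h → CS.inBlockᵢ-intro (CB.blockStart J) c' (proj₁ (CB.blockOf⇒between J c' (eqFin-elim h))) (proj₂ (CB.blockOf⇒between J c' (eqFin-elim h))))

    coef-singletonStart : ∀ v → start v ≡ true → singleton v ≡ true → coef v ≈ 1#
    coef-singletonStart v h1 h2 rewrite h1 | h2 = elt-index 1#

    rowCoef-unitOnSingletons : UnitOnSingletons RB.blockOf rowCoef
    rowCoef-unitOnSingletons r h = coef-singletonStart (r ↑ˡ n) isStart isSingleton
      where
      blockStart≡r : RB.blockStart (RB.blockOf r) ≡ r
      blockStart≡r = h (RB.blockStart (RB.blockOf r)) (RB.blockOf-blockStart (RB.blockOf r))
      isStart : start (r ↑ˡ n) ≡ true
      isStart = P.subst (λ z → RS.startᵢ z ≡ true) blockStart≡r (RB.blockStart-marked (RB.blockOf r))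
      isSingleton : singleton (r ↑ˡ n) ≡ true
      isSingleton = RS.singleton-intro r lem
        where
        lem : ∀ j → toℕ r < toℕ j → RS.inBlockᵢ r j ≡ false
        lem j lt with RS.inBlockᵢ r j in eqj
        ... | false = P.refl
        ... | true = ⊥-elim (ℕP.<⇒≢ lt
            (P.cong toℕ (P.sym (h j (eqFin-elim (P.trans (P.sym (rowBlock≡blockOf (RB.blockOf r) j)) (P.trans (P.cong (λ z → RS.inBlockᵢ z j) blockStart≡r) eqj)))))))

    colCoef-unitOnSingletons : UnitOnSingletons CB.blockOf colCoef
    colCoef-unitOnSingletons r h = coef-singletonStart (m ↑ʳ r) isStart isSingleton
      where
      blockStart≡r : CB.blockStart (CB.blockOf r) ≡ r
      blockStart≡r = h (CB.blockStart (CB.blockOf r)) (CB.blockOf-blockStart (CB.blockOf r))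
      isStart : start (m ↑ʳ r) ≡ true
      isStart = P.subst (λ z → CS.startᵢ z ≡ true) blockStart≡r (CB.blockStart-marked (CB.blockOf r))
      isSingleton : singleton (m ↑ʳ r) ≡ true
      isSingleton = CS.singleton-intro r lem
        where
        lem : ∀ j → toℕ r < toℕ j → CS.inBlockᵢ r j ≡ false
        lem j lt with CS.inBlockᵢ r j in eqj
        ... | false = P.refl
        ... | true = ⊥-elim (ℕP.<⇒≢ lt
            (P.cong toℕ (P.sym (h j (eqFin-elim (P.trans (P.sym (colBlock≡blockOf (CB.blockOf r) j)) (P.trans (P.cong (λ z → CS.inBlockᵢ z j) blockStart≡r) eqj)))))))

    linearMinor : LinearMinor N M
    linearMinor = contraction⇒linearMinor RB.blockOf CB.blockOf rowCoef colCoef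
        (RB.blockOf-mono , RB.blockOf-onto , rowCoef-unitOnSingletons) (CB.blockOf-mono , CB.blockOf-onto , colCoef-unitOnSingletons) N-def

    toMinor : V → Fin (m' ℕ.+ n')
    toMinor v with splitAt m v
    ... | inj₁ r = RB.blockOf r ↑ˡ n'
    ... | inj₂ c' = m' ↑ʳ CB.blockOf c'

    toMinor-↑ˡ : ∀ r → toMinor (r ↑ˡ n) ≡ RB.blockOf r ↑ˡ n'
    toMinor-↑ˡ r rewrite FinP.splitAt-↑ˡ m r n = P.refl
    toMinor-↑ʳ : ∀ c' → toMinor (m ↑ʳ c') ≡ m' ↑ʳ CB.blockOf c'
    toMinor-↑ʳ c' rewrite FinP.splitAt-↑ʳ m n c' = P.refl

    encRow-toMinor : ∀ v → isRow v ≡ encRel N row (λ _ → toMinor v)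
    encRow-toMinor v with splitView m n v
    ... | inj₁ (r , P.refl) = P.trans (isRow-↑ˡ r) (P.sym (P.trans (P.cong (λ k → encRel N row (λ _ → k)) (toMinor-↑ˡ r)) (encRow-↑ˡ N (RB.blockOf r))))
    ... | inj₂ (c' , P.refl) = P.trans (isRow-↑ʳ c') (P.sym (P.trans (P.cong (λ k → encRel N row (λ _ → k)) (toMinor-↑ʳ c')) (encRow-↑ʳ N (CB.blockOf c'))))

    ≤ᵇ-toMinor : ∀ v w → start v ≡ true → start w ≡ true → (toℕ v ≤ᵇ toℕ w) ≡ (toℕ (toMinor v) ≤ᵇ toℕ (toMinor w))
    ≤ᵇ-toMinor v w sv sw with splitView m n v | splitView m n w
    ... | inj₁ (r , P.refl) | inj₁ (r' , P.refl) =
      P.trans (≤ᵇ-cong (FinP.toℕ-↑ˡ r n) (FinP.toℕ-↑ˡ r' n))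
        (P.trans (≤ᵇ-ext (RB.blockOf-mono r r') (λ le → P.subst₂ _≤_ (P.cong toℕ (RB.blockStart-blockOf r sv)) (P.cong toℕ (RB.blockStart-blockOf r' sw)) (RB.blockStart-mono-≤ _ _ le)))
          (P.sym (≤ᵇ-cong (P.trans (P.cong toℕ (toMinor-↑ˡ r)) (FinP.toℕ-↑ˡ (RB.blockOf r) n')) (P.trans (P.cong toℕ (toMinor-↑ˡ r')) (FinP.toℕ-↑ˡ (RB.blockOf r') n')))))
    ... | inj₁ (r , P.refl) | inj₂ (c' , P.refl) =
      P.trans (≤ᵇ-intro (ℕP.<⇒≤ (↑ˡ<↑ʳ r c'))) (P.sym (P.trans (≤ᵇ-cong (P.cong toℕ (toMinor-↑ˡ r)) (P.cong toℕ (toMinor-↑ʳ c'))) (≤ᵇ-intro (ℕP.<⇒≤ (↑ˡ<↑ʳ (RB.blockOf r) (CB.blockOf c'))))))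
    ... | inj₂ (c' , P.refl) | inj₁ (r , P.refl) =
      P.trans (≤ᵇ-ext (λ le → ⊥-elim (ℕP.<⇒≱ (↑ˡ<↑ʳ r c') le)) (λ le → ⊥-elim (ℕP.<⇒≱ (↑ˡ<↑ʳ (RB.blockOf r) (CB.blockOf c')) le)))
        (P.sym (≤ᵇ-cong (P.cong toℕ (toMinor-↑ʳ c')) (P.cong toℕ (toMinor-↑ˡ r))))
    ... | inj₂ (c' , P.refl) | inj₂ (c'' , P.refl) =
      P.trans (≤ᵇ-cong (FinP.toℕ-↑ʳ m c') (FinP.toℕ-↑ʳ m c''))
        (P.trans (≤ᵇ-ext (λ le → ℕP.+-monoʳ-≤ m' (CB.blockOf-mono c' c'' (ℕP.+-cancelˡ-≤ m _ _ le)))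
                          (λ le → ℕP.+-monoʳ-≤ m (P.subst₂ _≤_ (P.cong toℕ (CB.blockStart-blockOf c' sv)) (P.cong toℕ (CB.blockStart-blockOf c'' sw)) (CB.blockStart-mono-≤ _ _ (ℕP.+-cancelˡ-≤ m' _ _ le)))))
          (P.sym (≤ᵇ-cong (P.trans (P.cong toℕ (toMinor-↑ʳ c')) (FinP.toℕ-↑ʳ m' (CB.blockOf c'))) (P.trans (P.cong toℕ (toMinor-↑ʳ c'')) (FinP.toℕ-↑ʳ m' (CB.blockOf c''))))))

    blockValue≈N : ∀ r c' → RS.startᵢ r ≡ true → CS.startᵢ c' ≡ true → blockValue (r ↑ˡ n) (m ↑ʳ c') ≈ N (RB.blockOf r) (CB.blockOf c')
    blockValue≈N r c' sr sc = trans (blockValue≈blockSum r c')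
        (trans (blockSum≈contract RB.blockOf CB.blockOf rowCoef colCoef M (RS.inBlockᵢ r) (CS.inBlockᵢ c') (RB.blockOf r) (CB.blockOf c') hP hQ) (sym (N-def (RB.blockOf r) (CB.blockOf c'))))
      where
      hP : ∀ r' → RS.inBlockᵢ r r' ≡ eqFin (RB.blockOf r') (RB.blockOf r)
      hP r' = P.trans (P.cong (λ z → RS.inBlockᵢ z r') (P.sym (RB.blockStart-blockOf r sr))) (rowBlock≡blockOf (RB.blockOf r) r')
      hQ : ∀ c'' → CS.inBlockᵢ c' c'' ≡ eqFin (CB.blockOf c'') (CB.blockOf c')
      hQ c'' = P.trans (P.cong (λ z → CS.inBlockᵢ z c'') (P.sym (CB.blockStart-blockOf c' sc))) (colBlock≡blockOf (CB.blockOf c') c'')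

    encE-toMinor : ∀ a p v w → start v ≡ true → start w ≡ true →
      (isRow v ∧ (not (isRow w) ∧ eqElt (blockValue v w) a)) ≡ encRel N (E (a , p)) (pair (toMinor v) (toMinor w))
    encE-toMinor a p v w sv sw with splitView m n v | splitView m n w
    ... | inj₁ (r , P.refl) | inj₂ (c' , P.refl) =
      P.trans (P.cong₂ (λ fromBool b2 → fromBool ∧ (not b2 ∧ eqElt (blockValue (r ↑ˡ n) (m ↑ʳ c')) a)) (isRow-↑ˡ r) (isRow-↑ʳ c'))
        (P.trans (eqElt-congˡ a (blockValue≈N r c' sv sw))
          (P.sym (P.trans (P.cong₂ (λ k k' → encRel N (E (a , p)) (pair k k')) (toMinor-↑ˡ r) (toMinor-↑ʳ c')) (encE-↑ˡ↑ʳ N a p (RB.blockOf r) (CB.blockOf c')))))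
    ... | inj₁ (r , P.refl) | inj₁ (r' , P.refl) =
      P.trans (P.cong₂ (λ fromBool b2 → fromBool ∧ (not b2 ∧ eqElt (blockValue (r ↑ˡ n) (r' ↑ˡ n)) a)) (isRow-↑ˡ r) (isRow-↑ˡ r'))
        (P.sym (P.trans (P.cong₂ (λ k k' → encRel N (E (a , p)) (pair k k')) (toMinor-↑ˡ r) (toMinor-↑ˡ r')) (encE-↑ˡ↑ˡ N a p (RB.blockOf r) (RB.blockOf r'))))
    ... | inj₂ (c' , P.refl) | _ =
      P.trans (P.cong (λ fromBool → fromBool ∧ (not (isRow w) ∧ eqElt (blockValue (m ↑ʳ c') w) a)) (isRow-↑ʳ c'))
        (P.sym (P.trans (P.cong (λ k → encRel N (E (a , p)) (pair k (toMinor w))) (toMinor-↑ʳ c')) (encE-↑ʳ N a p (CB.blockOf c') (toMinor w))))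

    isoToInterp⇒≅ : (B : Structure MSig) → IsoToInterp Tlm A B → B ≅ enc N
    isoToInterp⇒≅ B (f , finj , fsurj0 , fν0 , frel) = g , h , hg , gh , relB
      where
      fsurj : ∀ v → start v ≡ true → ∃[ x ] (f x ≡ v)
      fsurj v sv = fsurj0 v (P.trans (startF-sem {1} (λ _ → v) Fin.zero) sv)
      fν : ∀ x → start (f x) ≡ true
      fν x = P.trans (P.sym (startF-sem {1} (λ _ → f x) Fin.zero)) (fν0 x)
      g : Fin (size B) → Fin (m' ℕ.+ n')
      g x = toMinor (f x)
      hS : Fin m' ⊎ Fin n' → Fin (size B)
      hS (inj₁ i) = proj₁ (fsurj (RB.blockStart i ↑ˡ n) (RB.blockStart-marked i))
      hS (inj₂ j) = proj₁ (fsurj (m ↑ʳ CB.blockStart j) (CB.blockStart-marked j))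
      h : Fin (m' ℕ.+ n') → Fin (size B)
      h y = hS (splitAt m' y)
      ghS : ∀ sy → g (hS sy) ≡ Fin.join m' n' sy
      ghS (inj₁ i) = P.trans (P.cong toMinor (proj₂ (fsurj (RB.blockStart i ↑ˡ n) (RB.blockStart-marked i))))
          (P.trans (toMinor-↑ˡ (RB.blockStart i)) (P.cong (_↑ˡ n') (RB.blockOf-blockStart i)))
      ghS (inj₂ j) = P.trans (P.cong toMinor (proj₂ (fsurj (m ↑ʳ CB.blockStart j) (CB.blockStart-marked j))))
          (P.trans (toMinor-↑ʳ (CB.blockStart j)) (P.cong (m' ↑ʳ_) (CB.blockOf-blockStart j)))
      gh : ∀ y → g (h y) ≡ y
      gh y = P.trans (ghS (splitAt m' y)) (FinP.join-splitAt m' n' y)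
      hg : ∀ x → h (g x) ≡ x
      hg x with splitView m n (f x) | fν x
      ... | inj₁ (r , eqn) | sx = finj (P.trans (P.cong (f ∘ hS) sp)
          (P.trans (proj₂ (fsurj (RB.blockStart (RB.blockOf r) ↑ˡ n) (RB.blockStart-marked (RB.blockOf r))))
                                      (P.trans (P.cong (_↑ˡ n) (RB.blockStart-blockOf r (P.subst (λ z → start z ≡ true) eqn sx))) (P.sym eqn))))
        where
        sp : splitAt m' (g x) ≡ inj₁ (RB.blockOf r)
        sp = P.trans (P.cong (splitAt m') (P.trans (P.cong toMinor eqn) (toMinor-↑ˡ r))) (FinP.splitAt-↑ˡ m' (RB.blockOf r) n')
      ... | inj₂ (c' , eqn) | sx = finj (P.trans (P.cong (f ∘ hS) sp)
          (P.trans (proj₂ (fsurj (m ↑ʳ CB.blockStart (CB.blockOf c')) (CB.blockStart-marked (CB.blockOf c'))))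
                                      (P.trans (P.cong (m ↑ʳ_) (CB.blockStart-blockOf c' (P.subst (λ z → start z ≡ true) eqn sx))) (P.sym eqn))))
        where
        sp : splitAt m' (g x) ≡ inj₂ (CB.blockOf c')
        sp = P.trans (P.cong (splitAt m') (P.trans (P.cong toMinor eqn) (toMinor-↑ʳ c'))) (FinP.splitAt-↑ʳ m' n' (CB.blockOf c'))
      relB : ∀ R (t : Fin (arity MSig R) → Fin (size B)) → rel B R t ≡ rel (enc N) R (g ∘ t)
      relB row t = P.trans (frel row t) (P.trans (encRow-toMinor (f (t Fin.zero))) (P.sym (encRow-unary N (g ∘ t))))
      relB leq t = P.trans (frel leq t) (≤ᵇ-toMinor (f (t Fin.zero)) (f (t (Fin.suc Fin.zero))) (fν _) (fν _))
      relB (E (a , p)) t = P.trans (frel (E (a , p)) t) (P.trans (ρ-entry-sem (f ∘ t) a p)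
                             (P.trans (encE-toMinor a p (f (t Fin.zero)) (f (t (Fin.suc Fin.zero))) (fν _) (fν _)) (P.sym (encE-binary N (a , p) (g ∘ t)))))

  firstOr-eqFin : ∀ {k} (x d : Fin k) → firstOr (λ j → eqFin x j) d ≡ x
  firstOr-eqFin x d = P.sym (eqFin-elim (firstOr-holds (λ j → eqFin x j) d x (eqFin-intro P.refl)))

  module ToColouring {m n m' n'} (M : Matrix m n) (N : Matrix m' n') (π : Fin m → Fin m') (σ : Fin n → Fin n')
             (rowWeight : Fin m → Carrier) (colWeight : Fin n → Carrier) (π-adm : Admissible π rowWeight) (σ-adm : Admissible σ colWeight)
             (N≈ : ∀ I J → N I J ≈ contract π σ rowWeight colWeight M I J) where
    module RF = Fibres π (proj₁ π-adm) (proj₁ (proj₂ π-adm))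
    module CF = Fibres σ (proj₁ σ-adm) (proj₁ (proj₂ σ-adm))

    colouringˢ : Fin #colours → Fin m ⊎ Fin n → Bool
    colouringˢ Fin.zero (inj₁ r) = RF.isFirst r
    colouringˢ Fin.zero (inj₂ c') = CF.isFirst c'
    colouringˢ (Fin.suc j) (inj₁ r) = eqFin (index (rowWeight r)) j
    colouringˢ (Fin.suc j) (inj₂ c') = eqFin (index (colWeight c')) j

    colouring : Fin #colours → Fin (m ℕ.+ n) → Bool
    colouring j v = colouringˢ j (splitAt m v)

    colouring-↑ˡ : ∀ j r → colouring j (r ↑ˡ n) ≡ colouringˢ j (inj₁ r)
    colouring-↑ˡ j r rewrite FinP.splitAt-↑ˡ m r n = P.refl
    colouring-↑ʳ : ∀ j c' → colouring j (m ↑ʳ c') ≡ colouringˢ j (inj₂ c')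
    colouring-↑ʳ j c' rewrite FinP.splitAt-↑ʳ m n c' = P.refl

    open Semantics 𝔽 M colouring

    start-↑ˡ : ∀ r → start (r ↑ˡ n) ≡ RF.isFirst r
    start-↑ˡ r = Bool-ext fwd (λ h → P.trans (RS.start-unfold (r ↑ˡ n)) (∨-introˡ (P.trans (colouring-↑ˡ Fin.zero r) h)))
      where
      fwd : start (r ↑ˡ n) ≡ true → RF.isFirst r ≡ true
      fwd h with RS.start-elim r h
      ... | inj₁ q = P.trans (P.sym (colouring-↑ˡ Fin.zero r)) q
      ... | inj₂ q = RF.isFirst-0 r q

    start-↑ʳ : ∀ c' → start (m ↑ʳ c') ≡ CF.isFirst c'
    start-↑ʳ c' = Bool-ext fwd (λ h → P.trans (CS.start-unfold (m ↑ʳ c')) (∨-introˡ (P.trans (colouring-↑ʳ Fin.zero c') h)))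
      where
      fwd : start (m ↑ʳ c') ≡ true → CF.isFirst c' ≡ true
      fwd h with CS.start-elim c' h
      ... | inj₁ q = P.trans (P.sym (colouring-↑ʳ Fin.zero c')) q
      ... | inj₂ q = CF.isFirst-0 c' q

    colourIndex-↑ˡ : ∀ r → colourIndex (r ↑ˡ n) ≡ index (rowWeight r)
    colourIndex-↑ˡ r = P.trans (firstOr-cong _ _ index1 (λ j → colouring-↑ˡ (Fin.suc j) r)) (firstOr-eqFin (index (rowWeight r)) index1)
    colourIndex-↑ʳ : ∀ c' → colourIndex (m ↑ʳ c') ≡ index (colWeight c')
    colourIndex-↑ʳ c' = P.trans (firstOr-cong _ _ index1 (λ j → colouring-↑ʳ (Fin.suc j) c')) (firstOr-eqFin (index (colWeight c')) index1)

    rowBlock≡blockOf : ∀ I r → RS.inBlockᵢ (RF.firstOf I) r ≡ eqFin (π r) I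
    rowBlock≡blockOf I r = Bool-ext
      (λ h → eqFin-intro (RF.betweenFirsts⇒π I r (proj₁ (RS.inBlockᵢ-elim _ r h)) (λ l fl lt le → proj₂ (RS.inBlockᵢ-elim _ r h) l (P.trans (start-↑ˡ l) fl) lt le)))
      (λ h → RS.inBlockᵢ-intro _ r (proj₁ (RF.π⇒betweenFirsts I r (eqFin-elim h))) (λ l sl lt le → proj₂ (RF.π⇒betweenFirsts I r (eqFin-elim h)) l (P.trans (P.sym (start-↑ˡ l)) sl) lt le))

    colBlock≡blockOf : ∀ J c' → CS.inBlockᵢ (CF.firstOf J) c' ≡ eqFin (σ c') J
    colBlock≡blockOf J c' = Bool-ext
      (λ h → eqFin-intro (CF.betweenFirsts⇒π J c' (proj₁ (CS.inBlockᵢ-elim _ c' h)) (λ l fl lt le → proj₂ (CS.inBlockᵢ-elim _ c' h) l (P.trans (start-↑ʳ l) fl) lt le)))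
      (λ h → CS.inBlockᵢ-intro _ c' (proj₁ (CF.π⇒betweenFirsts J c' (eqFin-elim h))) (λ l sl lt le → proj₂ (CF.π⇒betweenFirsts J c' (eqFin-elim h)) l (P.trans (P.sym (start-↑ʳ l)) sl) lt le))

    coef-unfold : ∀ v → coef v ≡ elt (if singletonBlock v then index1 else colourIndex v)
    coef-unfold v = P.refl

    coef-↑ˡ : ∀ r → coef (r ↑ˡ n) ≈ rowWeight r
    coef-↑ˡ r = trans (reflexive (coef-unfold (r ↑ˡ n))) (lem (start (r ↑ˡ n)) (singleton (r ↑ˡ n)) P.refl P.refl)
      where
      lem : ∀ fromBool b2 → start (r ↑ˡ n) ≡ fromBool → singleton (r ↑ˡ n) ≡ b2 → elt (if fromBool ∧ b2 then index1 else colourIndex (r ↑ˡ n)) ≈ rowWeight r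
      lem false b2 _ _ = trans (reflexive (P.cong elt (colourIndex-↑ˡ r))) (elt-index (rowWeight r))
      lem true false _ _ = trans (reflexive (P.cong elt (colourIndex-↑ˡ r))) (elt-index (rowWeight r))
      lem true true s1 s2 = trans (elt-index 1#) (sym (proj₂ (proj₂ π-adm) r sing))
        where
        fr : RF.firstOf (π r) ≡ r
        fr = RF.firstOf-isFirst r (P.trans (P.sym (start-↑ˡ r)) s1)
        sing : ∀ s → π s ≡ π r → s ≡ r
        sing s q = FinP.toℕ-injective (ℕP.≤-antisym (ℕP.≮⇒≥ gt) (P.subst (λ z → toℕ z ≤ toℕ s) fr (RF.firstOf-least (π r) s q)))
          where
          gt : toℕ r < toℕ s → ⊥
          gt lt = true≢false (P.trans (P.cong (λ z → RS.inBlockᵢ z s) (P.sym fr)) (P.trans (rowBlock≡blockOf (π r) s) (eqFin-intro q))) (RS.singleton-elim r s2 s lt)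

    coef-↑ʳ : ∀ c' → coef (m ↑ʳ c') ≈ colWeight c'
    coef-↑ʳ r = trans (reflexive (coef-unfold (m ↑ʳ r))) (lem (start (m ↑ʳ r)) (singleton (m ↑ʳ r)) P.refl P.refl)
      where
      lem : ∀ fromBool b2 → start (m ↑ʳ r) ≡ fromBool → singleton (m ↑ʳ r) ≡ b2 → elt (if fromBool ∧ b2 then index1 else colourIndex (m ↑ʳ r)) ≈ colWeight r
      lem false b2 _ _ = trans (reflexive (P.cong elt (colourIndex-↑ʳ r))) (elt-index (colWeight r))
      lem true false _ _ = trans (reflexive (P.cong elt (colourIndex-↑ʳ r))) (elt-index (colWeight r))
      lem true true s1 s2 = trans (elt-index 1#) (sym (proj₂ (proj₂ σ-adm) r sing))
        where
        fr : CF.firstOf (σ r) ≡ r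
        fr = CF.firstOf-isFirst r (P.trans (P.sym (start-↑ʳ r)) s1)
        sing : ∀ s → σ s ≡ σ r → s ≡ r
        sing s q = FinP.toℕ-injective (ℕP.≤-antisym (ℕP.≮⇒≥ gt) (P.subst (λ z → toℕ z ≤ toℕ s) fr (CF.firstOf-least (σ r) s q)))
          where
          gt : toℕ r < toℕ s → ⊥
          gt lt = true≢false (P.trans (P.cong (λ z → CS.inBlockᵢ z s) (P.sym fr)) (P.trans (colBlock≡blockOf (σ r) s) (eqFin-intro q))) (CS.singleton-elim r s2 s lt)

    fromMinorˢ : Fin m' ⊎ Fin n' → V
    fromMinorˢ (inj₁ i) = RF.firstOf i ↑ˡ n
    fromMinorˢ (inj₂ j) = m ↑ʳ CF.firstOf j
    fromMinor : Fin (m' ℕ.+ n') → V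
    fromMinor k = fromMinorˢ (splitAt m' k)

    fromMinor-↑ˡ : ∀ i → fromMinor (i ↑ˡ n') ≡ RF.firstOf i ↑ˡ n
    fromMinor-↑ˡ i rewrite FinP.splitAt-↑ˡ m' i n' = P.refl
    fromMinor-↑ʳ : ∀ j → fromMinor (m' ↑ʳ j) ≡ m ↑ʳ CF.firstOf j
    fromMinor-↑ʳ j rewrite FinP.splitAt-↑ʳ m' n' j = P.refl

    toMinorˢ : Fin m ⊎ Fin n → Fin (m' ℕ.+ n')
    toMinorˢ (inj₁ r) = π r ↑ˡ n'
    toMinorˢ (inj₂ c') = m' ↑ʳ σ c'
    toMinor : V → Fin (m' ℕ.+ n')
    toMinor v = toMinorˢ (splitAt m v)

    toMinor-fromMinorˢ : ∀ s → toMinor (fromMinorˢ s) ≡ Fin.join m' n' s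
    toMinor-fromMinorˢ (inj₁ i) rewrite FinP.splitAt-↑ˡ m (RF.firstOf i) n = P.cong (_↑ˡ n') (RF.π-firstOf i)
    toMinor-fromMinorˢ (inj₂ j) rewrite FinP.splitAt-↑ʳ m n (CF.firstOf j) = P.cong (m' ↑ʳ_) (CF.π-firstOf j)

    toMinor-fromMinor : ∀ k → toMinor (fromMinor k) ≡ k
    toMinor-fromMinor k = P.trans (toMinor-fromMinorˢ (splitAt m' k)) (FinP.join-splitAt m' n' k)

    fromMinor-toMinor : ∀ v → start v ≡ true → fromMinor (toMinor v) ≡ v
    fromMinor-toMinor v sv with splitView m n v
    ... | inj₁ (r , P.refl) rewrite FinP.splitAt-↑ˡ m r n | fromMinor-↑ˡ (π r) = P.cong (_↑ˡ n) (RF.firstOf-isFirst r (P.trans (P.sym (start-↑ˡ r)) sv))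
    ... | inj₂ (c' , P.refl) rewrite FinP.splitAt-↑ʳ m n c' | fromMinor-↑ʳ (σ c') = P.cong (m ↑ʳ_) (CF.firstOf-isFirst c' (P.trans (P.sym (start-↑ʳ c')) sv))

    start-fromMinor : ∀ k → start (fromMinor k) ≡ true
    start-fromMinor k with splitView m' n' k
    ... | inj₁ (i , P.refl) rewrite fromMinor-↑ˡ i = P.trans (start-↑ˡ (RF.firstOf i)) (RF.isFirst-firstOf i)
    ... | inj₂ (j , P.refl) rewrite fromMinor-↑ʳ j = P.trans (start-↑ʳ (CF.firstOf j)) (CF.isFirst-firstOf j)

    ≤ᵇ-fromMinor : ∀ k k' → (toℕ k ≤ᵇ toℕ k') ≡ (toℕ (fromMinor k) ≤ᵇ toℕ (fromMinor k'))
    ≤ᵇ-fromMinor k k' with splitView m' n' k | splitView m' n' k'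
    ... | inj₁ (i , P.refl) | inj₁ (i' , P.refl) rewrite fromMinor-↑ˡ i | fromMinor-↑ˡ i' | FinP.toℕ-↑ˡ i n' | FinP.toℕ-↑ˡ i' n' | FinP.toℕ-↑ˡ (RF.firstOf i) n | FinP.toℕ-↑ˡ (RF.firstOf i') n =
      ≤ᵇ-ext (RF.firstOf-mono-≤ i i') (RF.firstOf-cancel-≤ i i')
    ... | inj₁ (i , P.refl) | inj₂ (j , P.refl) rewrite fromMinor-↑ˡ i | fromMinor-↑ʳ j =
      P.trans (≤ᵇ-intro (ℕP.<⇒≤ (↑ˡ<↑ʳ i j))) (P.sym (≤ᵇ-intro (ℕP.<⇒≤ (↑ˡ<↑ʳ (RF.firstOf i) (CF.firstOf j)))))
    ... | inj₂ (j , P.refl) | inj₁ (i , P.refl) rewrite fromMinor-↑ˡ i | fromMinor-↑ʳ j =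
      ≤ᵇ-ext (λ le → ⊥-elim (ℕP.<⇒≱ (↑ˡ<↑ʳ i j) le)) (λ le → ⊥-elim (ℕP.<⇒≱ (↑ˡ<↑ʳ (RF.firstOf i) (CF.firstOf j)) le))
    ... | inj₂ (j , P.refl) | inj₂ (j' , P.refl) rewrite fromMinor-↑ʳ j | fromMinor-↑ʳ j' | FinP.toℕ-↑ʳ m' j | FinP.toℕ-↑ʳ m' j' | FinP.toℕ-↑ʳ m (CF.firstOf j) | FinP.toℕ-↑ʳ m (CF.firstOf j') =
      ≤ᵇ-ext (λ le → ℕP.+-monoʳ-≤ m (CF.firstOf-mono-≤ j j' (ℕP.+-cancelˡ-≤ m' _ _ le)))
              (λ le → ℕP.+-monoʳ-≤ m' (CF.firstOf-cancel-≤ j j' (ℕP.+-cancelˡ-≤ m _ _ le)))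

    encRow-fromMinor : ∀ k → encRel N row (λ _ → k) ≡ isRow (fromMinor k)
    encRow-fromMinor k with splitView m' n' k
    ... | inj₁ (i , P.refl) rewrite fromMinor-↑ˡ i | isRow-↑ˡ (RF.firstOf i) = encRow-↑ˡ N i
    ... | inj₂ (j , P.refl) rewrite fromMinor-↑ʳ j | isRow-↑ʳ (CF.firstOf j) = encRow-↑ʳ N j

    blockValue≈N : ∀ i j → blockValue (RF.firstOf i ↑ˡ n) (m ↑ʳ CF.firstOf j) ≈ N i j
    blockValue≈N i j = trans (blockValue≈blockSum (RF.firstOf i) (CF.firstOf j))
                 (trans (blockSum≈contract π σ rowCoef colCoef M (RS.inBlockᵢ (RF.firstOf i)) (CS.inBlockᵢ (CF.firstOf j)) i j (rowBlock≡blockOf i) (colBlock≡blockOf j))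
                 (trans (contract-cong {π = π} {π} {σ} {σ} {rowCoef} {rowWeight} {colCoef}
                     {colWeight} {M} {M} (λ _ → P.refl) (λ _ → P.refl) coef-↑ˡ coef-↑ʳ (λ _ _ → refl) i j)
                 (sym (N≈ i j))))

    encE-fromMinor : ∀ a p k k' → encRel N (E (a , p)) (pair k k') ≡
        (isRow (fromMinor k) ∧ (not (isRow (fromMinor k')) ∧ eqElt (blockValue (fromMinor k) (fromMinor k')) a))
    encE-fromMinor a p k k' with splitView m' n' k | splitView m' n' k'
    ... | inj₁ (i , P.refl) | inj₂ (j , P.refl) = lemIJ (blockValue≈N i j)
      where
      lemIJ : blockValue (RF.firstOf i ↑ˡ n) (m ↑ʳ CF.firstOf j) ≈ N i j →
        encRel N (E (a , p)) (pair (i ↑ˡ n') (m' ↑ʳ j)) ≡ (isRow (fromMinor (i ↑ˡ n')) ∧ (not (isRow (fromMinor (m' ↑ʳ j))) ∧ eqElt (blockValue (fromMinor (i ↑ˡ n')) (fromMinor (m' ↑ʳ j))) a))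
      lemIJ q rewrite fromMinor-↑ˡ i | fromMinor-↑ʳ j | isRow-↑ˡ (RF.firstOf i) | isRow-↑ʳ (CF.firstOf j) = P.trans (encE-↑ˡ↑ʳ N a p i j) (P.sym (eqElt-congˡ a q))
    ... | inj₁ (i , P.refl) | inj₁ (i' , P.refl) rewrite fromMinor-↑ˡ i | fromMinor-↑ˡ i' | isRow-↑ˡ (RF.firstOf i) | isRow-↑ˡ (RF.firstOf i') = encE-↑ˡ↑ˡ N a p i i'
    ... | inj₂ (j , P.refl) | _ rewrite fromMinor-↑ʳ j | isRow-↑ʳ (CF.firstOf j) = encE-↑ʳ N a p j k'

    ≅⇒isoToInterp : (B : Structure MSig) → B ≅ enc N → IsoToInterp Tlm A B
    ≅⇒isoToInterp B (φ , ψ , ψφ , φψ , relφ) = f , finj , (λ v sv → fsurj v (P.trans (P.sym (startF-sem {1} (λ _ → v) Fin.zero)) sv))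
        , (λ x → P.trans (startF-sem {1} (λ _ → f x) Fin.zero) (fν x)) , frel
      where
      f : Fin (size B) → V
      f x = fromMinor (φ x)
      finj : ∀ {x y} → f x ≡ f y → x ≡ y
      finj {x} {y} q = P.trans (P.sym (ψφ x))
          (P.trans (P.cong ψ (P.trans (P.sym (toMinor-fromMinor (φ x))) (P.trans (P.cong toMinor q) (toMinor-fromMinor (φ y))))) (ψφ y))
      fsurj : ∀ v → start v ≡ true → ∃[ x ] (f x ≡ v)
      fsurj v sv = ψ (toMinor v) , P.trans (P.cong fromMinor (φψ (toMinor v))) (fromMinor-toMinor v sv)
      fν : ∀ x → start (f x) ≡ true
      fν x = start-fromMinor (φ x)
      frel : ∀ R (t : Fin (arity MSig R) → Fin (size B)) → rel B R t ≡ eval A (ρ-Tlm R) (f ∘ t)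
      frel row t = P.trans (relφ row t) (P.trans (encRow-unary N (φ ∘ t)) (encRow-fromMinor (φ (t Fin.zero))))
      frel leq t = P.trans (relφ leq t) (≤ᵇ-fromMinor (φ (t Fin.zero)) (φ (t (Fin.suc Fin.zero))))
      frel (E (a , p)) t = P.trans (relφ (E (a , p)) t) (P.trans (encE-binary N (a , p) (φ ∘ t))
                             (P.trans (encE-fromMinor a p (φ (t Fin.zero)) (φ (t (Fin.suc Fin.zero)))) (P.sym (ρ-entry-sem (f ∘ t) a p))))

  transduction-sound : ∀ {m n} (M : Matrix m n) B → (B ∈T[ Tlm ]) (enc M) →
    ∃[ m' ] ∃[ n' ] Σ (Matrix m' n') λ N → LinearMinor N M × (B ≅ enc N)
  transduction-sound M B (c , B≅TM) =
    m' , n' , N , linearMinor , isoToInterp⇒≅ B B≅TM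
    where open FromColouring M c

  transduction-complete : ∀ {m n m' n'} (M : Matrix m n) (N : Matrix m' n') → LinearMinor N M →
    ∀ B → B ≅ enc N → (B ∈T[ Tlm ]) (enc M)
  transduction-complete M N N≤M B B≅N with linearMinor⇒contraction N≤M
  ... | π , σ , a , b , π-adm , σ-adm , N≈ = colouring , ≅⇒isoToInterp B B≅N
    where open ToColouring M N π σ a b π-adm σ-adm N≈

lemma29 : (𝔽 : FiniteField) →
    let open Matrices 𝔽 in
    Σ (Transduction MSig MSig) λ Tlm →
      (𝓜 : MatrixPred) → IsMatrixClass 𝓜 →
      (B : Structure MSig) →
        (InTImage Tlm 𝓜 B → B ∈LMClosure 𝓜) × (B ∈LMClosure 𝓜 → InTImage Tlm 𝓜 B)
lemma29 𝔽 = Tlm , λ 𝓜 _ B → image⊆closure 𝓜 B , closure⊆image 𝓜 B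
  where
  open Matrices 𝔽
  open Transducer 𝔽 using (Tlm)
  open Correctness 𝔽

  image⊆closure : ∀ 𝓜 B → InTImage Tlm 𝓜 B → B ∈LMClosure 𝓜
  image⊆closure 𝓜 B (m , n , M , M∈𝓜 , B∈TM) = m , n , M , M∈𝓜 , transduction-sound M B B∈TM

  closure⊆image : ∀ 𝓜 B → B ∈LMClosure 𝓜 → InTImage Tlm 𝓜 B
  closure⊆image 𝓜 B (m , n , M , M∈𝓜 , m' , n' , N , N≤M , B≅N) =
    m , n , M , M∈𝓜 , transduction-complete M N N≤M B B≅N
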